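{- Let $k\ge 1$ and let $(\mathbb{N}_1,\ldots,\mathbb{N}_t)$ be a set partition of $\mathbb{N}=\{1,2,3,\ldots\}$. For each $1\le i\le t$ and each $s\in\mathbb{N}_i$ with $1\le s\le k$, $$A_k(s)=\frac{q_iy_i}{1-q_i(z_i-y_i)}A_k+\frac{q_i(1-y_i)}{1-q_i(z_i-y_i)}+\frac{q_i(x_i-y_i)}{1-q_i(z_i-y_i)}\sum_{j=1}^{s-1}A_k(j).$$
   Context: $[k]=\{1,\ldots,k\}$. For a word $\pi=\pi_1\cdots\pi_n$ over $[k]$ and $X\subseteq\mathbb{N}$, let $\overleftarrow{\mathrm{des}}_X(\pi)=|\{i:\pi_i>\pi_{i+1},\ \pi_i\in X\}|$, $\overleftarrow{\mathrm{ris}}_X(\pi)=|\{i:\pi_i<\pi_{i+1},\ \pi_i\in X\}|$, $\mathrm{lev}_X(\pi)=|\{i:\pi_i=\pi_{i+1},\ \pi_i\in X\}|$, and let $c_m(\pi)$ be the number of letters of $\pi$ lying in $\mathbb{N}_m$. Define the formal power series (in variables $x_m,y_m,z_m,q_m$, $1\le m\le t$) $$A_k=\sum_{\pi}\prod_{m=1}^{t}x_m^{\overleftarrow{\mathrm{des}}_{\mathbb{N}_m}(\pi)}y_m^{\overleftarrow{\mathrm{ris}}_{\mathbb{N}_m}(\pi)}z_m^{\mathrm{lev}_{\mathbb{N}_m}(\pi)}q_m^{c_m(\pi)},$$ the sum over all words over $[k]$ of all lengths $n\ge 0$ (including the empty word), and for $j\in[k]$ let $A_k(j)$ be the same sum restricted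 to nonempty words with first letter $\pi_1=j$. Quotients are taken in the ring of formal power series. -}

module Defs where

open import Data.Nat as ℕ using (ℕ; zero; suc; _∸_; _<ᵇ_; _≡ᵇ_)
import Data.Nat.Properties as ℕP
open import Data.Integer as ℤ using (ℤ; +_; _+_; _-_; _*_; -_)
open import Data.Fin using (Fin)
import Data.Fin as Fin
open import Data.Bool using (Bool; true; false; if_then_else_; _∧_)
open import Data.Product using (_×_; _,_; proj₁; proj₂)
import Data.Product.Properties as ×P
open import Data.Vec as Vec using (Vec; []; _∷_)
import Data.Vec.Properties as VecP
open import Data.List as List using (List; []; _∷_; upTo; concatMap; map; foldr; filter; length)
open import Relation.Binary.PropositionalEquality using (_≡_)
open import Relation.Binary.Definitions using (DecidableEquality)
open import Relation.Nullary.Decidable using (⌊_⌋)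

-- Monomials in the variables x_m, y_m, z_m, q_m  (m : Fin t).
-- Component m of a monomial is the exponent tuple (a , b , c , d) of
-- x_m^a y_m^b z_m^c q_m^d.

Q4 : Set
Q4 = ℕ × ℕ × ℕ × ℕ

Mono : ℕ → Set
Mono t = Vec Q4 t

_≟Q4_ : DecidableEquality Q4
_≟Q4_ = ×P.≡-dec ℕP._≟_ (×P.≡-dec ℕP._≟_ (×P.≡-dec ℕP._≟_ ℕP._≟_))

_≟M_ : ∀ {t} → DecidableEquality (Mono t)
_≟M_ = VecP.≡-dec _≟Q4_

mzero : ∀ {t} → Mono t
mzero = Vec.replicate _ (0 , 0 , 0 , 0)

deg : ∀ {t} → Mono t → ℕ
deg [] = 0
deg ((a , b , c , d) ∷ e) = a ℕ.+ b ℕ.+ c ℕ.+ d ℕ.+ deg e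

qdeg : ∀ {t} → Mono t → ℕ
qdeg [] = 0
qdeg ((_ , _ , _ , d) ∷ e) = d ℕ.+ qdeg e

splitsℕ : ℕ → List (ℕ × ℕ)
splitsℕ n = map (λ i → i , n ∸ i) (upTo (suc n))

splitsQ4 : Q4 → List (Q4 × Q4)
splitsQ4 (a , b , c , d) =
  concatMap (λ { (a₁ , a₂) →
  concatMap (λ { (b₁ , b₂) →
  concatMap (λ { (c₁ , c₂) →
  map (λ { (d₁ , d₂) → (a₁ , b₁ , c₁ , d₁) , (a₂ , b₂ , c₂ , d₂) })
      (splitsℕ d) }) (splitsℕ c) }) (splitsℕ b) }) (splitsℕ a)

splits : ∀ {t} → Mono t → List (Mono t × Mono t)
splits [] = ([] , []) ∷ []
splits (p ∷ e) =
  concatMap (λ { (p₁ , p₂) → map (λ { (e₁ , e₂) → (p₁ ∷ e₁) , (p₂ ∷ e₂) }) (splits e) })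
            (splitsQ4 p)

PS : ℕ → Set
PS t = Mono t → ℤ

sumℤ : List ℤ → ℤ
sumℤ = foldr _+_ (+ 0)

_⊕_ : ∀ {t} → PS t → PS t → PS t
(f ⊕ g) e = f e + g e

_⊖_ : ∀ {t} → PS t → PS t → PS t
(f ⊖ g) e = f e - g e

_⊗_ : ∀ {t} → PS t → PS t → PS t
(f ⊗ g) e = sumℤ (map (λ { (e₁ , e₂) → f e₁ * g e₂ }) (splits e))

infixl 6 _⊕_ _⊖_
infixl 7 _⊗_

mono : ∀ {t} → Mono t → PS t
mono m e = if ⌊ e ≟M m ⌋ then + 1 else + 0

𝟘 𝟙 : ∀ {t} → PS t
𝟘 _ = + 0
𝟙 = mono mzero

_^ˢ_ : ∀ {t} → PS t → ℕ → PS t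
f ^ˢ zero = 𝟙
f ^ˢ suc n = f ⊗ (f ^ˢ n)

-- For a series g with zero constant term, 1/(1 - g) = Σ_{n ≥ 0} g^n;
-- the coefficient at e only receives contributions from n ≤ deg e.
inv1m : ∀ {t} → PS t → PS t
inv1m g e = sumℤ (map (λ n → (g ^ˢ n) e) (upTo (suc (deg e))))

_÷1-_ : ∀ {t} → PS t → PS t → PS t
f ÷1- g = f ⊗ inv1m g

infixl 7 _÷1-_

unitAt : ∀ {t} → Fin t → Q4 → Mono t
unitAt {suc t} Fin.zero    p = p ∷ mzero
unitAt {suc t} (Fin.suc m) p = (0 , 0 , 0 , 0) ∷ unitAt m p

xv yv zv qv : ∀ {t} → Fin t → PS t
xv m = mono (unitAt m (1 , 0 , 0 , 0))
yv m = mono (unitAt m (0 , 1 , 0 , 0))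
zv m = mono (unitAt m (0 , 0 , 1 , 0))
qv m = mono (unitAt m (0 , 0 , 0 , 1))

-- Words and their statistics.
-- A set partition (ℕ₁,…,ℕₜ) of ℕ = {1,2,…} is given by a block map
-- blk : ℕ → Fin t  (blk n = m  iff  n ∈ ℕ_{m+1}; the value at 0 is irrelevant).

letters : ℕ → List ℕ
letters k = map suc (upTo k)

words : ℕ → ℕ → List (List ℕ)
words k zero = [] ∷ []
words k (suc n) = concatMap (λ a → map (a ∷_) (words k n)) (letters k)

addAt : ∀ {t} → Fin t → Q4 → Mono t → Mono t
addAt Fin.zero (a , b , c , d) ((a' , b' , c' , d') ∷ e) =
  (a ℕ.+ a' , b ℕ.+ b' , c ℕ.+ c' , d ℕ.+ d') ∷ e
addAt (Fin.suc m) p (q ∷ e) = q ∷ addAt m p e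

-- contribution of an adjacent pair π_i π_{i+1} = a b (attributed to the block of a)
pairStat : ℕ → ℕ → Q4
pairStat a b =
  if b <ᵇ a then (1 , 0 , 0 , 0)
  else if a <ᵇ b then (0 , 1 , 0 , 0)
  else (0 , 0 , 1 , 0)

-- the monomial  ∏_m x_m^{des_{ℕ_m}} y_m^{ris_{ℕ_m}} z_m^{lev_{ℕ_m}} q_m^{c_m}  of a word
stat : ∀ {t} → (ℕ → Fin t) → List ℕ → Mono t
stat blk [] = mzero
stat blk (a ∷ []) = addAt (blk a) (0 , 0 , 0 , 1) mzero
stat blk (a ∷ b ∷ π) =
  addAt (blk a) (0 , 0 , 0 , 1) (addAt (blk a) (pairStat a b) (stat blk (b ∷ π)))

-- A word over [k] has length Σ_m c_m = qdeg of its monomial, so the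
-- coefficient of a monomial e in A_k is the number of words of length qdeg e
-- with monomial e.
A : ∀ {t} → (ℕ → Fin t) → ℕ → PS t
A blk k e = + length (filter (λ π → stat blk π ≟M e) (words k (qdeg e)))

headIs : ℕ → List ℕ → Bool
headIs j [] = false
headIs j (a ∷ _) = a ≡ᵇ j

Aj : ∀ {t} → (ℕ → Fin t) → ℕ → ℕ → PS t
Aj blk k j e =
  + length (filter (λ π → stat blk π ≟M e)
                   (List.filterᵇ (headIs j) (words k (qdeg e))))

sumAj : ∀ {t} → (ℕ → Fin t) → ℕ → ℕ → PS t
sumAj blk k s = foldr _⊕_ 𝟘 (map (Aj blk k) (map suc (upTo (s ∸ 1))))

{-# OPTIONS --safe #-}
-- Removing the first letter of a word starting with s gives
--   A_k(s) = q_i (1 + Σ_b w(s,b) A_k(b)),   w(s,b) = x_i, z_i, y_i as b < s, b = s, b > s.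
-- Writing w(s,b) = y_i + [b < s](x_i - y_i) + [b = s](z_i - y_i) and Σ_b A_k(b) = A_k - 1
-- turns this into a linear equation T = N + q_i(z_i - y_i) T for T = A_k(s), with N the
-- numerator of the claimed formula. As q_i(z_i - y_i) has no constant term, this equation
-- has exactly one solution in formal power series, namely N / (1 - q_i(z_i - y_i)).
-- Every product in the argument has a left factor built from monomials, and multiplying by
-- a monomial only shifts coefficients; this is all of the Cauchy product the proof uses.
module Submission where

open import Defs
open import Algebra.Bundles using (CommutativeMonoid)
open import Data.Bool using (Bool; true; false; T; not; if_then_else_; _∧_; _∨_)
open import Data.Bool.Properties using (∧-commutativeMonoid; ∧-conicalˡ; ∧-conicalʳ; T-≡)
open import Algebra.Properties.CommutativeSemigroup (CommutativeMonoid.commutativeSemigroup ∧-commutativeMonoid)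
  using () renaming (interchange to ∧-interchange)
open import Data.Empty using (⊥-elim)
open import Data.Fin using (Fin)
import Data.Fin as Fin
open import Data.Integer using (ℤ; +_; _+_; _-_; _*_)
import Data.Integer.Properties as ℤP
open import Data.Integer.Tactic.RingSolver using (solve-∀)
import Data.Nat.Tactic.RingSolver as ℕSolver
open import Data.List as List using (List; []; _∷_; _++_; map; concatMap; upTo; applyUpTo; filter; length; foldr)
import Data.List.Properties as LP
open import Data.Nat as ℕ using (ℕ; zero; suc; _∸_; _≤_; _<_; z≤n; s≤s; _≤ᵇ_; _<ᵇ_; _≡ᵇ_)
import Data.Nat.Properties as ℕP
open import Data.Product using (Σ; _×_; _,_; proj₁; proj₂; uncurry)
open import Data.Vec using ([]; _∷_)
open import Function using (_∘_; Equivalence)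
open import Relation.Binary.PropositionalEquality
open import Relation.Nullary using (yes; no)
open import Relation.Nullary.Decidable using (⌊_⌋)

∑ : {A : Set} → List A → (A → ℤ) → ℤ
∑ xs f = sumℤ (map f xs)

infix 5 ∑
syntax ∑ xs (λ x → e) = ∑[ x ∈ xs ] e

when : Bool → ℤ → ℤ
when b x = if b then x else + 0

when-∧ : ∀ b c x → when (b ∧ c) x ≡ when b (when c x)
when-∧ true  c x = refl
when-∧ false c x = refl

when-comm : ∀ b c x → when b (when c x) ≡ when c (when b x)
when-comm true  c     x = refl
when-comm false true  x = refl
when-comm false false x = refl

when-+ : ∀ b x y → when b (x + y) ≡ when b x + when b y
when-+ true  x y = refl
when-+ false x y = refl

when-- : ∀ b x y → when b (x - y) ≡ when b x - when b y
when-- true  x y = refl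
when-- false x y = refl

when-*ˡ : ∀ b x y → when b x * y ≡ when b (x * y)
when-*ˡ true  x y = refl
when-*ˡ false x y = refl

module _ {A : Set} where

  ∑-cong : (xs : List A) {f g : A → ℤ} → (∀ x → f x ≡ g x) → ∑ xs f ≡ ∑ xs g
  ∑-cong []       f≗g = refl
  ∑-cong (x ∷ xs) f≗g = cong₂ _+_ (f≗g x) (∑-cong xs f≗g)

  ∑-zero : (xs : List A) → ∑[ _ ∈ xs ] + 0 ≡ + 0
  ∑-zero []       = refl
  ∑-zero (x ∷ xs) = trans (ℤP.+-identityˡ _) (∑-zero xs)

  ∑-++ : (xs ys : List A) (f : A → ℤ) → ∑ (xs ++ ys) f ≡ ∑ xs f + ∑ ys f
  ∑-++ []       ys f = sym (ℤP.+-identityˡ _)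
  ∑-++ (x ∷ xs) ys f = trans (cong (_+_ (f x)) (∑-++ xs ys f)) (sym (ℤP.+-assoc (f x) _ _))

  ∑-+ : (xs : List A) (f g : A → ℤ) → ∑[ x ∈ xs ] (f x + g x) ≡ ∑ xs f + ∑ xs g
  ∑-+ []       f g = refl
  ∑-+ (x ∷ xs) f g = trans (cong (_+_ (f x + g x)) (∑-+ xs f g)) (interchange (f x) (g x) _ _)
    where
    interchange : ∀ a b c d → a + b + (c + d) ≡ a + c + (b + d)
    interchange = solve-∀

  ∑-- : (xs : List A) (f g : A → ℤ) → ∑[ x ∈ xs ] (f x - g x) ≡ ∑ xs f - ∑ xs g
  ∑-- []       f g = refl
  ∑-- (x ∷ xs) f g = trans (cong (_+_ (f x - g x)) (∑-- xs f g)) (interchange (f x) (g x) _ _)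
    where
    interchange : ∀ a b c d → a - b + (c - d) ≡ a + c - (b + d)
    interchange = solve-∀

  ∑-when : (xs : List A) (b : Bool) (f : A → ℤ) → ∑[ x ∈ xs ] when b (f x) ≡ when b (∑ xs f)
  ∑-when xs true  f = refl
  ∑-when xs false f = ∑-zero xs

  ∑-filterᵇ : (p : A → Bool) (xs : List A) (f : A → ℤ) →
              ∑ (List.filterᵇ p xs) f ≡ ∑[ x ∈ xs ] when (p x) (f x)
  ∑-filterᵇ p []       f = refl
  ∑-filterᵇ p (x ∷ xs) f with p x
  ... | true  = cong (_+_ (f x)) (∑-filterᵇ p xs f)
  ... | false = trans (∑-filterᵇ p xs f) (sym (ℤP.+-identityˡ _))

  module _ {B : Set} where

    ∑-map : (xs : List B) (g : B → A) (f : A → ℤ) → ∑ (map g xs) f ≡ ∑ xs (f ∘ g)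
    ∑-map []       g f = refl
    ∑-map (x ∷ xs) g f = cong (_+_ (f (g x))) (∑-map xs g f)

    ∑-concatMap : (xs : List B) (g : B → List A) (f : A → ℤ) →
                  ∑ (concatMap g xs) f ≡ ∑[ x ∈ xs ] ∑ (g x) f
    ∑-concatMap []       g f = refl
    ∑-concatMap (x ∷ xs) g f = trans (∑-++ (g x) _ f) (cong (_+_ (∑ (g x) f)) (∑-concatMap xs g f))

∑-upTo-suc : (n : ℕ) (f : ℕ → ℤ) → ∑ (upTo (suc n)) f ≡ f 0 + ∑ (upTo n) (f ∘ suc)
∑-upTo-suc n f = cong (_+_ (f 0)) (begin
  ∑ (applyUpTo suc n) f         ≡⟨ cong (λ xs → ∑ xs f) (LP.map-upTo suc n) ⟨
  ∑ (map suc (upTo n)) f        ≡⟨ ∑-map (upTo n) suc f ⟩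
  ∑ (upTo n) (f ∘ suc)          ∎)
  where open ≡-Reasoning

∑-upTo-sucʳ : (n : ℕ) (f : ℕ → ℤ) → ∑ (upTo (suc n)) f ≡ ∑ (upTo n) f + f n
∑-upTo-sucʳ n f = begin
  ∑ (upTo (suc n)) f            ≡⟨ cong (λ xs → ∑ xs f) (LP.upTo-∷ʳ n) ⟨
  ∑ (upTo n List.∷ʳ n) f        ≡⟨ ∑-++ (upTo n) (n ∷ []) f ⟩
  ∑ (upTo n) f + (f n + + 0)    ≡⟨ cong (_+_ (∑ (upTo n) f)) (ℤP.+-identityʳ (f n)) ⟩
  ∑ (upTo n) f + f n            ∎
  where open ≡-Reasoning

-- A commutative monoid of monomials, written multiplicatively, in which every
-- element has finitely many factorisations: `∑splits x φ` sums `φ a b` over all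
-- `a · b = x`. `m ∣ᵇ a` decides divisibility and `a / m` is the cofactor, a junk
-- value when `m` does not divide `a`.
record SplitMonoid (X : Set) : Set where
  infixl 7 _·_ _/_
  infix 4 _∣ᵇ_ _==_
  field
    ε : X
    _·_ _/_ : X → X → X
    _∣ᵇ_ _==_ : X → X → Bool
    ∑splits : X → (X → X → ℤ) → ℤ
    ∑splits-cong : ∀ x {φ ψ : X → X → ℤ} → (∀ a b → φ a b ≡ ψ a b) → ∑splits x φ ≡ ∑splits x ψ
    ∑splits-zero : ∀ x → ∑splits x (λ _ _ → + 0) ≡ + 0
    ∑splits-divisible : ∀ x m (φ : X → X → ℤ) →
      ∑splits x (λ a b → when (m ∣ᵇ a) (φ (a / m) b)) ≡ when (m ∣ᵇ x) (∑splits (x / m) φ)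
    ∑splits-unit : ∀ x (φ : X → ℤ) → ∑splits x (λ a b → when (a == ε) (φ b)) ≡ φ x
    ·-identityʳ : ∀ m → m · ε ≡ m
    ·-comm : ∀ m n → m · n ≡ n · m
    ==-· : ∀ a m x → (a == m · x) ≡ ((m ∣ᵇ a) ∧ (a / m == x))
    ∣ᵇ-· : ∀ m n a → (m · n ∣ᵇ a) ≡ ((m ∣ᵇ a) ∧ (n ∣ᵇ a / m))
    /-/ : ∀ a m n → a / m / n ≡ a / (m · n)
    ε-∣ᵇ : ∀ a → (ε ∣ᵇ a) ≡ true
    /-identityʳ : ∀ a → a / ε ≡ a
    ==⇒≡ : ∀ a b → (a == b) ≡ true → a ≡ b
    ==-refl : ∀ a → (a == a) ≡ true
    /-·-cancel : ∀ a m → (m ∣ᵇ a) ≡ true → a / m · m ≡ a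

  ∑splits-when : ∀ x c (φ : X → X → ℤ) → ∑splits x (λ a b → when c (φ a b)) ≡ when c (∑splits x φ)
  ∑splits-when x true  φ = refl
  ∑splits-when x false φ = ∑splits-zero x

≤ᵇ-suc : ∀ m n → (suc m ≤ᵇ suc n) ≡ (m ≤ᵇ n)
≤ᵇ-suc zero    n = refl
≤ᵇ-suc (suc m) n = refl

≡ᵇ-trichotomy : ∀ m n → (m ≡ᵇ n) ≡ not ((m <ᵇ n) ∨ (n <ᵇ m))
≡ᵇ-trichotomy zero    zero    = refl
≡ᵇ-trichotomy zero    (suc n) = refl
≡ᵇ-trichotomy (suc m) zero    = refl
≡ᵇ-trichotomy (suc m) (suc n) = ≡ᵇ-trichotomy m n

module ℕ-SplitMonoid where

  ∑splitsℕ : ℕ → (ℕ → ℕ → ℤ) → ℤ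
  ∑splitsℕ zero    φ = φ 0 0
  ∑splitsℕ (suc x) φ = φ 0 (suc x) + ∑splitsℕ x (λ a b → φ (suc a) b)

  ∑splitsℕ-cong : ∀ x {φ ψ : ℕ → ℕ → ℤ} → (∀ a b → φ a b ≡ ψ a b) →
                  ∑splitsℕ x φ ≡ ∑splitsℕ x ψ
  ∑splitsℕ-cong zero    φ≗ψ = φ≗ψ 0 0
  ∑splitsℕ-cong (suc x) φ≗ψ = cong₂ _+_ (φ≗ψ 0 (suc x)) (∑splitsℕ-cong x (λ a → φ≗ψ (suc a)))

  ∑splitsℕ-zero : ∀ x → ∑splitsℕ x (λ _ _ → + 0) ≡ + 0
  ∑splitsℕ-zero zero    = refl
  ∑splitsℕ-zero (suc x) = trans (ℤP.+-identityˡ _) (∑splitsℕ-zero x)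

  ∑splitsℕ-divisible : ∀ x m (φ : ℕ → ℕ → ℤ) →
    ∑splitsℕ x (λ a b → when (m ≤ᵇ a) (φ (a ∸ m) b)) ≡ when (m ≤ᵇ x) (∑splitsℕ (x ∸ m) φ)
  ∑splitsℕ-divisible x       zero    φ = refl
  ∑splitsℕ-divisible zero    (suc m) φ = refl
  ∑splitsℕ-divisible (suc x) (suc m) φ = begin
    + 0 + ∑splitsℕ x (λ a b → when (suc m ≤ᵇ suc a) (φ (a ∸ m) b))
      ≡⟨ ℤP.+-identityˡ _ ⟩
    ∑splitsℕ x (λ a b → when (suc m ≤ᵇ suc a) (φ (a ∸ m) b))
      ≡⟨ ∑splitsℕ-cong x (λ a b → cong (λ c → when c (φ (a ∸ m) b)) (≤ᵇ-suc m a)) ⟩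
    ∑splitsℕ x (λ a b → when (m ≤ᵇ a) (φ (a ∸ m) b))
      ≡⟨ ∑splitsℕ-divisible x m φ ⟩
    when (m ≤ᵇ x) (∑splitsℕ (x ∸ m) φ)
      ≡⟨ cong (λ c → when c (∑splitsℕ (x ∸ m) φ)) (≤ᵇ-suc m x) ⟨
    when (suc m ≤ᵇ suc x) (∑splitsℕ (x ∸ m) φ) ∎
    where open ≡-Reasoning

  ∑splitsℕ-unit : ∀ x (φ : ℕ → ℤ) → ∑splitsℕ x (λ a b → when (a ≡ᵇ 0) (φ b)) ≡ φ x
  ∑splitsℕ-unit zero    φ = refl
  ∑splitsℕ-unit (suc x) φ = trans (cong (_+_ (φ (suc x))) (∑splitsℕ-zero x)) (ℤP.+-identityʳ _)

  ≡ᵇ-+ : ∀ a m x → (a ≡ᵇ m ℕ.+ x) ≡ ((m ≤ᵇ a) ∧ (a ∸ m ≡ᵇ x))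
  ≡ᵇ-+ a       zero    x = refl
  ≡ᵇ-+ zero    (suc m) x = refl
  ≡ᵇ-+ (suc a) (suc m) x rewrite ≤ᵇ-suc m a = ≡ᵇ-+ a m x

  ≤ᵇ-+ : ∀ m n a → (m ℕ.+ n ≤ᵇ a) ≡ ((m ≤ᵇ a) ∧ (n ≤ᵇ a ∸ m))
  ≤ᵇ-+ zero    n a       = refl
  ≤ᵇ-+ (suc m) n zero    = refl
  ≤ᵇ-+ (suc m) n (suc a) rewrite ≤ᵇ-suc (m ℕ.+ n) a | ≤ᵇ-suc m a = ≤ᵇ-+ m n a

  ≡ᵇ-refl : ∀ a → (a ≡ᵇ a) ≡ true
  ≡ᵇ-refl zero    = refl
  ≡ᵇ-refl (suc a) = ≡ᵇ-refl a

  splitMonoid : SplitMonoid ℕ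
  splitMonoid = record
    { ε                 = 0
    ; _·_               = ℕ._+_
    ; _/_               = _∸_
    ; _∣ᵇ_              = _≤ᵇ_
    ; _==_              = _≡ᵇ_
    ; ∑splits           = ∑splitsℕ
    ; ∑splits-cong      = ∑splitsℕ-cong
    ; ∑splits-zero      = ∑splitsℕ-zero
    ; ∑splits-divisible = ∑splitsℕ-divisible
    ; ∑splits-unit      = ∑splitsℕ-unit
    ; ·-identityʳ       = ℕP.+-identityʳ
    ; ·-comm            = ℕP.+-comm
    ; ==-·              = ≡ᵇ-+
    ; ∣ᵇ-·              = ≤ᵇ-+
    ; /-/               = ℕP.∸-+-assoc
    ; ε-∣ᵇ              = λ _ → refl
    ; /-identityʳ       = λ _ → refl
    ; ==⇒≡              = λ a b h → ℕP.≡ᵇ⇒≡ a b (Equivalence.from T-≡ h)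
    ; ==-refl           = ≡ᵇ-refl
    ; /-·-cancel        = λ a m h → ℕP.m∸n+n≡m (ℕP.≤ᵇ⇒≤ m a (Equivalence.from T-≡ h))
    }

module ×-SplitMonoid {X Y : Set} (SX : SplitMonoid X) (SY : SplitMonoid Y) where
  private
    module A = SplitMonoid SX
    module B = SplitMonoid SY

  ∑splits : X × Y → (X × Y → X × Y → ℤ) → ℤ
  ∑splits (x , y) φ = A.∑splits x (λ x₁ x₂ → B.∑splits y (λ y₁ y₂ → φ (x₁ , y₁) (x₂ , y₂)))

  _·_ _/_ : X × Y → X × Y → X × Y
  (a , b) · (c , d) = a A.· c , b B.· d
  (a , b) / (c , d) = a A./ c , b B./ d

  _∣ᵇ_ _==_ : X × Y → X × Y → Bool
  (a , b) ∣ᵇ (c , d) = (a A.∣ᵇ c) ∧ (b B.∣ᵇ d)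
  (a , b) == (c , d) = (a A.== c) ∧ (b B.== d)

  ∑splits-divisible : ∀ x m (φ : X × Y → X × Y → ℤ) →
    ∑splits x (λ a b → when (m ∣ᵇ a) (φ (a / m) b)) ≡ when (m ∣ᵇ x) (∑splits (x / m) φ)
  ∑splits-divisible (x , y) (mx , my) φ = begin
    ΣX x (λ x₁ x₂ → ΣY y (λ y₁ y₂ → when (mx∣ x₁ ∧ my∣ y₁) (ψ (x₁ A./ mx) (y₁ B./ my) x₂ y₂)))
      ≡⟨ A.∑splits-cong x (λ x₁ x₂ → trans (B.∑splits-cong y (λ y₁ y₂ → when-∧ (mx∣ x₁) _ _))
                                            (B.∑splits-when y (mx∣ x₁) _)) ⟩
    ΣX x (λ x₁ x₂ → when (mx∣ x₁) (ΣY y (λ y₁ y₂ → when (my∣ y₁) (ψ (x₁ A./ mx) (y₁ B./ my) x₂ y₂))))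
      ≡⟨ A.∑splits-cong x (λ x₁ x₂ → trans (cong (when (mx∣ x₁)) (B.∑splits-divisible y my _))
                                            (when-comm (mx∣ x₁) (my∣ y) _)) ⟩
    ΣX x (λ x₁ x₂ → when (my∣ y) (when (mx∣ x₁) (ΣY (y B./ my) (λ y₁ y₂ → ψ (x₁ A./ mx) y₁ x₂ y₂))))
      ≡⟨ A.∑splits-when x (my∣ y) _ ⟩
    when (my∣ y) (ΣX x (λ x₁ x₂ → when (mx∣ x₁) (ΣY (y B./ my) (λ y₁ y₂ → ψ (x₁ A./ mx) y₁ x₂ y₂))))
      ≡⟨ cong (when (my∣ y)) (A.∑splits-divisible x mx _) ⟩
    when (my∣ y) (when (mx∣ x) (ΣX (x A./ mx) (λ x₁ x₂ → ΣY (y B./ my) (λ y₁ y₂ → ψ x₁ y₁ x₂ y₂))))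
      ≡⟨ trans (when-comm (my∣ y) (mx∣ x) _) (sym (when-∧ (mx∣ x) (my∣ y) _)) ⟩
    when (mx∣ x ∧ my∣ y) (ΣX (x A./ mx) (λ x₁ x₂ → ΣY (y B./ my) (λ y₁ y₂ → ψ x₁ y₁ x₂ y₂))) ∎
    where
    open ≡-Reasoning
    ΣX : X → (X → X → ℤ) → ℤ
    ΣX = A.∑splits
    ΣY : Y → (Y → Y → ℤ) → ℤ
    ΣY = B.∑splits
    mx∣ : X → Bool
    mx∣ a = mx A.∣ᵇ a
    my∣ : Y → Bool
    my∣ b = my B.∣ᵇ b
    ψ : X → Y → X → Y → ℤ
    ψ x₁ y₁ x₂ y₂ = φ (x₁ , y₁) (x₂ , y₂)

  ∑splits-unit : ∀ x (φ : X × Y → ℤ) → ∑splits x (λ a b → when (a == (A.ε , B.ε)) (φ b)) ≡ φ x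
  ∑splits-unit (x , y) φ =
    trans (A.∑splits-cong x (λ x₁ x₂ →
             trans (B.∑splits-cong y (λ y₁ y₂ → when-∧ (x₁ A.== A.ε) (y₁ B.== B.ε) _))
             (trans (B.∑splits-when y (x₁ A.== A.ε) _)
                    (cong (when (x₁ A.== A.ε)) (B.∑splits-unit y (λ y₂ → φ (x₂ , y₂)))))))
          (A.∑splits-unit x (λ x₂ → φ (x₂ , y)))

  splitMonoid : SplitMonoid (X × Y)
  splitMonoid = record
    { ε                 = A.ε , B.ε
    ; _·_               = _·_
    ; _/_               = _/_
    ; _∣ᵇ_              = _∣ᵇ_
    ; _==_              = _==_
    ; ∑splits           = ∑splits
    ; ∑splits-cong      = λ { (x , y) φ≗ψ → A.∑splits-cong x (λ x₁ x₂ →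
                                             B.∑splits-cong y (λ y₁ y₂ → φ≗ψ (x₁ , y₁) (x₂ , y₂))) }
    ; ∑splits-zero      = λ { (x , y) →
                            trans (A.∑splits-cong x (λ _ _ → B.∑splits-zero y)) (A.∑splits-zero x) }
    ; ∑splits-divisible = ∑splits-divisible
    ; ∑splits-unit      = ∑splits-unit
    ; ·-identityʳ       = λ { (a , b) → cong₂ _,_ (A.·-identityʳ a) (B.·-identityʳ b) }
    ; ·-comm            = λ { (a , b) (c , d) → cong₂ _,_ (A.·-comm a c) (B.·-comm b d) }
    ; ==-·              = λ { (a , b) (m , n) (x , y) →
                            trans (cong₂ _∧_ (A.==-· a m x) (B.==-· b n y))
                                  (∧-interchange (m A.∣ᵇ a) (a A./ m A.== x) (n B.∣ᵇ b) (b B./ n B.== y)) }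
    ; ∣ᵇ-·              = λ { (m , n) (m′ , n′) (a , b) →
                            trans (cong₂ _∧_ (A.∣ᵇ-· m m′ a) (B.∣ᵇ-· n n′ b))
                                  (∧-interchange (m A.∣ᵇ a) (m′ A.∣ᵇ a A./ m) (n B.∣ᵇ b) (n′ B.∣ᵇ b B./ n)) }
    ; /-/               = λ { (a , b) (m , n) (m′ , n′) → cong₂ _,_ (A./-/ a m m′) (B./-/ b n n′) }
    ; ε-∣ᵇ              = λ { (a , b) → cong₂ _∧_ (A.ε-∣ᵇ a) (B.ε-∣ᵇ b) }
    ; /-identityʳ       = λ { (a , b) → cong₂ _,_ (A./-identityʳ a) (B./-identityʳ b) }
    ; ==⇒≡              = λ { (a , b) (c , d) h →
                            cong₂ _,_ (A.==⇒≡ a c (∧-conicalˡ _ _ h)) (B.==⇒≡ b d (∧-conicalʳ _ _ h)) }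
    ; ==-refl           = λ { (a , b) → cong₂ _∧_ (A.==-refl a) (B.==-refl b) }
    ; /-·-cancel        = λ { (a , b) (m , n) h →
                            cong₂ _,_ (A./-·-cancel a m (∧-conicalˡ _ _ h))
                                      (B./-·-cancel b n (∧-conicalʳ _ _ h)) }
    }

Q4-splitMonoid : SplitMonoid Q4
Q4-splitMonoid = ℕS ×S (ℕS ×S (ℕS ×S ℕS))
  where
  ℕS = ℕ-SplitMonoid.splitMonoid
  _×S_ = ×-SplitMonoid.splitMonoid

mono-splitMonoid : (t : ℕ) → SplitMonoid (Mono t)
mono-splitMonoid zero = record
  { ε                 = []
  ; _·_               = λ _ _ → []
  ; _/_               = λ _ _ → []
  ; _∣ᵇ_              = λ _ _ → true
  ; _==_              = λ _ _ → true
  ; ∑splits           = λ _ φ → φ [] []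
  ; ∑splits-cong      = λ { [] φ≗ψ → φ≗ψ [] [] }
  ; ∑splits-zero      = λ _ → refl
  ; ∑splits-divisible = λ { [] [] φ → refl }
  ; ∑splits-unit      = λ { [] φ → refl }
  ; ·-identityʳ       = λ { [] → refl }
  ; ·-comm            = λ _ _ → refl
  ; ==-·              = λ _ _ _ → refl
  ; ∣ᵇ-·              = λ _ _ _ → refl
  ; /-/               = λ _ _ _ → refl
  ; ε-∣ᵇ              = λ _ → refl
  ; /-identityʳ       = λ { [] → refl }
  ; ==⇒≡              = λ { [] [] _ → refl }
  ; ==-refl           = λ _ → refl
  ; /-·-cancel        = λ { [] [] _ → refl }
  }
mono-splitMonoid (suc t) = record
  { ε                 = fromPair P.ε
  ; _·_               = λ u v → fromPair (toPair u P.· toPair v)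
  ; _/_               = λ u v → fromPair (toPair u P./ toPair v)
  ; _∣ᵇ_              = λ u v → toPair u P.∣ᵇ toPair v
  ; _==_              = λ u v → toPair u P.== toPair v
  ; ∑splits           = λ u φ → P.∑splits (toPair u) (λ a b → φ (fromPair a) (fromPair b))
  ; ∑splits-cong      = λ { (p ∷ e) φ≗ψ →
                          P.∑splits-cong (p , e) (λ a b → φ≗ψ (fromPair a) (fromPair b)) }
  ; ∑splits-zero      = λ { (p ∷ e) → P.∑splits-zero (p , e) }
  ; ∑splits-divisible = λ { (p ∷ e) (m ∷ n) φ →
                          P.∑splits-divisible (p , e) (m , n) (λ a b → φ (fromPair a) (fromPair b)) }
  ; ∑splits-unit      = λ { (p ∷ e) φ → P.∑splits-unit (p , e) (φ ∘ fromPair) }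
  ; ·-identityʳ       = λ { (p ∷ e) → cong fromPair (P.·-identityʳ (p , e)) }
  ; ·-comm            = λ { (p ∷ e) (q ∷ f) → cong fromPair (P.·-comm (p , e) (q , f)) }
  ; ==-·              = λ { (a ∷ u) (m ∷ n) (x ∷ v) → P.==-· (a , u) (m , n) (x , v) }
  ; ∣ᵇ-·              = λ { (m ∷ n) (m′ ∷ n′) (a ∷ u) → P.∣ᵇ-· (m , n) (m′ , n′) (a , u) }
  ; /-/               = λ { (a ∷ u) (m ∷ n) (m′ ∷ n′) →
                          cong fromPair (P./-/ (a , u) (m , n) (m′ , n′)) }
  ; ε-∣ᵇ              = λ { (a ∷ u) → P.ε-∣ᵇ (a , u) }
  ; /-identityʳ       = λ { (a ∷ u) → cong fromPair (P./-identityʳ (a , u)) }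
  ; ==⇒≡              = λ { (a ∷ u) (b ∷ v) h → cong fromPair (P.==⇒≡ (a , u) (b , v) h) }
  ; ==-refl           = λ { (a ∷ u) → P.==-refl (a , u) }
  ; /-·-cancel        = λ { (a ∷ u) (m ∷ n) h → cong fromPair (P./-·-cancel (a , u) (m , n) h) }
  }
  where
  module P = SplitMonoid (×-SplitMonoid.splitMonoid Q4-splitMonoid (mono-splitMonoid t))

  toPair : Mono (suc t) → Q4 × Mono t
  toPair (p ∷ e) = p , e

  fromPair : Q4 × Mono t → Mono (suc t)
  fromPair (p , e) = p ∷ e

∑-splitsℕ : ∀ a (φ : ℕ → ℕ → ℤ) → ∑ (splitsℕ a) (uncurry φ) ≡ ℕ-SplitMonoid.∑splitsℕ a φ
∑-splitsℕ a φ = trans (∑-map (upTo (suc a)) (λ i → i , a ∸ i) (uncurry φ)) (∑-upTo-∸ a φ)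
  where
  ∑-upTo-∸ : ∀ a (φ : ℕ → ℕ → ℤ) → ∑[ i ∈ upTo (suc a) ] φ i (a ∸ i) ≡ ℕ-SplitMonoid.∑splitsℕ a φ
  ∑-upTo-∸ zero    φ = ℤP.+-identityʳ _
  ∑-upTo-∸ (suc a) φ = trans (∑-upTo-suc (suc a) (λ i → φ i (suc a ∸ i)))
                             (cong (_+_ (φ 0 (suc a))) (∑-upTo-∸ a (λ i → φ (suc i))))

∑-splitsQ4 : ∀ p (φ : Q4 → Q4 → ℤ) → ∑ (splitsQ4 p) (uncurry φ) ≡ SplitMonoid.∑splits Q4-splitMonoid p φ
∑-splitsQ4 (a , b , c , d) φ =
  trans (∑-concatMap-splitsℕ a byA (uncurry φ)) (∑splitsℕ-cong a (λ a₁ a₂ →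
  trans (∑-concatMap-splitsℕ b (byB a₁ a₂) (uncurry φ)) (∑splitsℕ-cong b (λ b₁ b₂ →
  trans (∑-concatMap-splitsℕ c (byC a₁ a₂ b₁ b₂) (uncurry φ)) (∑splitsℕ-cong c (λ c₁ c₂ →
  trans (∑-map (splitsℕ d) (λ dd → (a₁ , b₁ , c₁ , proj₁ dd) , (a₂ , b₂ , c₂ , proj₂ dd)) (uncurry φ))
        (∑-splitsℕ d _)))))))
  where
  open ℕ-SplitMonoid using (∑splitsℕ; ∑splitsℕ-cong)
  ∑-concatMap-splitsℕ : ∀ x (g : ℕ × ℕ → List (Q4 × Q4)) (f : Q4 × Q4 → ℤ) →
    ∑ (concatMap g (splitsℕ x)) f ≡ ∑splitsℕ x (λ x₁ x₂ → ∑ (g (x₁ , x₂)) f)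
  ∑-concatMap-splitsℕ x g f =
    trans (∑-concatMap (splitsℕ x) g f) (∑-splitsℕ x (λ x₁ x₂ → ∑ (g (x₁ , x₂)) f))
  byC : ℕ → ℕ → ℕ → ℕ → ℕ × ℕ → List (Q4 × Q4)
  byC a₁ a₂ b₁ b₂ (c₁ , c₂) =
    map (λ { (d₁ , d₂) → (a₁ , b₁ , c₁ , d₁) , (a₂ , b₂ , c₂ , d₂) }) (splitsℕ d)
  byB : ℕ → ℕ → ℕ × ℕ → List (Q4 × Q4)
  byB a₁ a₂ (b₁ , b₂) = concatMap (byC a₁ a₂ b₁ b₂) (splitsℕ c)
  byA : ℕ × ℕ → List (Q4 × Q4)
  byA (a₁ , a₂) = concatMap (byB a₁ a₂) (splitsℕ b)

∑-splits : ∀ {t} (e : Mono t) (φ : Mono t → Mono t → ℤ) →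
           ∑ (splits e) (uncurry φ) ≡ SplitMonoid.∑splits (mono-splitMonoid t) e φ
∑-splits []      φ = ℤP.+-identityʳ _
∑-splits (p ∷ e) φ =
  trans (∑-concatMap (splitsQ4 p) consSplits (uncurry φ))
  (trans (∑-cong (splitsQ4 p) (λ { (p₁ , p₂) →
            trans (∑-map (splits e) _ (uncurry φ)) (∑-splits e (λ e₁ e₂ → φ (p₁ ∷ e₁) (p₂ ∷ e₂))) }))
         (∑-splitsQ4 p _))
  where
  consSplits : Q4 × Q4 → List (Mono _ × Mono _)
  consSplits (p₁ , p₂) = map (λ { (e₁ , e₂) → (p₁ ∷ e₁) , (p₂ ∷ e₂) }) (splits e)

private
  module MonoidOps {t : ℕ} = SplitMonoid (mono-splitMonoid t)
open MonoidOps

mzero≡ε : ∀ {t} → mzero {t} ≡ ε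
mzero≡ε {zero}  = refl
mzero≡ε {suc t} = cong (_ ∷_) mzero≡ε

·-identityˡ : ∀ {t} (m : Mono t) → ε · m ≡ m
·-identityˡ m = trans (·-comm ε m) (·-identityʳ m)

==-ε : ∀ {t} (a m : Mono t) → (a == m) ≡ ((m ∣ᵇ a) ∧ (a / m == ε))
==-ε a m = trans (cong (a ==_) (sym (·-identityʳ m))) (==-· a m ε)

⌊≟M⌋ : ∀ {t} (e m : Mono t) → ⌊ e ≟M m ⌋ ≡ (e == m)
⌊≟M⌋ e m with e ≟M m | e == m in e==m
... | yes refl | _     = trans (sym (==-refl e)) e==m
... | no  e≢m  | true  = ⊥-elim (e≢m (==⇒≡ e m e==m))
... | no  _    | false = refl

deg-· : ∀ {t} (u v : Mono t) → deg (u · v) ≡ deg u ℕ.+ deg v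
deg-· []                    []                       = refl
deg-· ((a , b , c , d) ∷ u) ((a′ , b′ , c′ , d′) ∷ v) =
  trans (cong (a ℕ.+ a′ ℕ.+ (b ℕ.+ b′) ℕ.+ (c ℕ.+ c′) ℕ.+ (d ℕ.+ d′) ℕ.+_) (deg-· u v))
        (regroup a b c d a′ b′ c′ d′ (deg u) (deg v))
  where
  regroup : ∀ a b c d a′ b′ c′ d′ x y →
    a ℕ.+ a′ ℕ.+ (b ℕ.+ b′) ℕ.+ (c ℕ.+ c′) ℕ.+ (d ℕ.+ d′) ℕ.+ (x ℕ.+ y)
    ≡ a ℕ.+ b ℕ.+ c ℕ.+ d ℕ.+ x ℕ.+ (a′ ℕ.+ b′ ℕ.+ c′ ℕ.+ d′ ℕ.+ y)
  regroup = ℕSolver.solve-∀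

qdeg-· : ∀ {t} (u v : Mono t) → qdeg (u · v) ≡ qdeg u ℕ.+ qdeg v
qdeg-· []                    []                       = refl
qdeg-· ((_ , _ , _ , d) ∷ u) ((_ , _ , _ , d′) ∷ v) =
  trans (cong (d ℕ.+ d′ ℕ.+_) (qdeg-· u v)) (regroup d d′ (qdeg u) (qdeg v))
  where
  regroup : ∀ d d′ x y → d ℕ.+ d′ ℕ.+ (x ℕ.+ y) ≡ d ℕ.+ x ℕ.+ (d′ ℕ.+ y)
  regroup = ℕSolver.solve-∀

deg-/ : ∀ {t} (e m : Mono t) → (m ∣ᵇ e) ≡ true → deg (e / m) ℕ.+ deg m ≡ deg e
deg-/ e m m∣e = trans (sym (deg-· (e / m) m)) (cong deg (/-·-cancel e m m∣e))

qdeg-/ : ∀ {t} (e m : Mono t) → (m ∣ᵇ e) ≡ true → qdeg (e / m) ℕ.+ qdeg m ≡ qdeg e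
qdeg-/ e m m∣e = trans (sym (qdeg-· (e / m) m)) (cong qdeg (/-·-cancel e m m∣e))

deg-/-≤ : ∀ {t} (e m : Mono t) → (m ∣ᵇ e) ≡ true → deg (e / m) ≤ deg e
deg-/-≤ e m m∣e = subst (deg (e / m) ≤_) (deg-/ e m m∣e) (ℕP.m≤m+n _ _)

deg-/-< : ∀ {t} (e m : Mono t) → 0 < deg m → (m ∣ᵇ e) ≡ true → deg (e / m) < deg e
deg-/-< e m m-pos m∣e = subst (deg (e / m) <_) (deg-/ e m m∣e) (ℕP.m<m+n _ m-pos)

deg-mzero : ∀ {t} → deg (mzero {t}) ≡ 0
deg-mzero {zero}  = refl
deg-mzero {suc t} = deg-mzero {t}

qdeg-mzero : ∀ {t} → qdeg (mzero {t}) ≡ 0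
qdeg-mzero {zero}  = refl
qdeg-mzero {suc t} = qdeg-mzero {t}

deg-unitAt : ∀ {t} (i : Fin t) (a b c d : ℕ) → deg (unitAt i (a , b , c , d)) ≡ a ℕ.+ b ℕ.+ c ℕ.+ d
deg-unitAt {suc t} Fin.zero    a b c d =
  trans (cong (a ℕ.+ b ℕ.+ c ℕ.+ d ℕ.+_) (deg-mzero {t})) (ℕP.+-identityʳ _)
deg-unitAt {suc t} (Fin.suc i) a b c d = deg-unitAt i a b c d

qdeg-unitAt : ∀ {t} (i : Fin t) (a b c d : ℕ) → qdeg (unitAt i (a , b , c , d)) ≡ d
qdeg-unitAt {suc t} Fin.zero    a b c d = trans (cong (d ℕ.+_) (qdeg-mzero {t})) (ℕP.+-identityʳ d)
qdeg-unitAt {suc t} (Fin.suc i) a b c d = qdeg-unitAt i a b c d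

addAt-· : ∀ {t} (i : Fin t) (p : Q4) (v : Mono t) → addAt i p v ≡ unitAt i p · v
addAt-· Fin.zero    (a , b , c , d) (_ ∷ v) = cong (_ ∷_) (sym (trans (cong (_· v) mzero≡ε) (·-identityˡ v)))
addAt-· (Fin.suc i) p               (_ ∷ v) = cong (_ ∷_) (addAt-· i p v)

module _ {t : ℕ} where

  shift : Mono t → PS t → PS t
  shift m F e = when (m ∣ᵇ e) (F (e / m))

  ⊗-∑splits : (F G : PS t) (e : Mono t) → (F ⊗ G) e ≡ ∑splits e (λ a b → F a * G b)
  ⊗-∑splits F G e = ∑-splits e (λ a b → F a * G b)

  mono-when : (m e : Mono t) → mono m e ≡ when (e == m) (+ 1)
  mono-when m e = cong (λ b → if b then + 1 else + 0) (⌊≟M⌋ e m)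

  𝟙-qdeg-suc : (e : Mono t) {n : ℕ} → qdeg e ≡ suc n → 𝟙 e ≡ + 0
  𝟙-qdeg-suc e qdeg-e with e ≟M mzero
  ... | yes refl = ⊥-elim (ℕP.0≢1+n (trans (sym (qdeg-mzero {t})) qdeg-e))
  ... | no  _    = refl

  mono-refl : (m : Mono t) → mono m m ≡ + 1
  mono-refl m = trans (mono-when m m) (cong (λ b → when b (+ 1)) (==-refl m))

  mono-≢ : {m e : Mono t} → e ≢ m → mono m e ≡ + 0
  mono-≢ {m = m} {e} e≢m with e ≟M m
  ... | yes e≡m = ⊥-elim (e≢m e≡m)
  ... | no  _   = refl

  mono-⊗ : (m : Mono t) (F : PS t) → mono m ⊗ F ≗ shift m F
  mono-⊗ m F e = begin
    (mono m ⊗ F) e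
      ≡⟨ ⊗-∑splits (mono m) F e ⟩
    ∑splits e (λ a b → mono m a * F b)
      ≡⟨ ∑splits-cong e (λ a b → coefficient a (F b)) ⟩
    ∑splits e (λ a b → when (m ∣ᵇ a) (when (a / m == ε) (F b)))
      ≡⟨ ∑splits-divisible e m (λ a b → when (a == ε) (F b)) ⟩
    when (m ∣ᵇ e) (∑splits (e / m) (λ a b → when (a == ε) (F b)))
      ≡⟨ cong (when (m ∣ᵇ e)) (∑splits-unit (e / m) F) ⟩
    shift m F e ∎
    where
    open ≡-Reasoning
    coefficient : ∀ a x → mono m a * x ≡ when (m ∣ᵇ a) (when (a / m == ε) x)
    coefficient a x = begin
      mono m a * x                       ≡⟨ cong (_* x) (mono-when m a) ⟩
      when (a == m) (+ 1) * x            ≡⟨ when-*ˡ (a == m) (+ 1) x ⟩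
      when (a == m) (+ 1 * x)            ≡⟨ cong₂ when (==-ε a m) (ℤP.*-identityˡ x) ⟩
      when ((m ∣ᵇ a) ∧ (a / m == ε)) x   ≡⟨ when-∧ (m ∣ᵇ a) _ x ⟩
      when (m ∣ᵇ a) (when (a / m == ε) x) ∎

  shift-⊗ : (m : Mono t) (F G : PS t) → shift m F ⊗ G ≗ shift m (F ⊗ G)
  shift-⊗ m F G e = begin
    (shift m F ⊗ G) e
      ≡⟨ ⊗-∑splits (shift m F) G e ⟩
    ∑splits e (λ a b → when (m ∣ᵇ a) (F (a / m)) * G b)
      ≡⟨ ∑splits-cong e (λ a b → when-*ˡ (m ∣ᵇ a) (F (a / m)) (G b)) ⟩
    ∑splits e (λ a b → when (m ∣ᵇ a) (F (a / m) * G b))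
      ≡⟨ ∑splits-divisible e m (λ a b → F a * G b) ⟩
    when (m ∣ᵇ e) (∑splits (e / m) (λ a b → F a * G b))
      ≡⟨ cong (when (m ∣ᵇ e)) (⊗-∑splits F G (e / m)) ⟨
    shift m (F ⊗ G) e ∎
    where open ≡-Reasoning

  ⊗-cong : {F F′ G G′ : PS t} → F ≗ F′ → G ≗ G′ → F ⊗ G ≗ F′ ⊗ G′
  ⊗-cong F≗F′ G≗G′ e = ∑-cong (splits e) (λ { (a , b) → cong₂ _*_ (F≗F′ a) (G≗G′ b) })

  ⊗-congˡ : {F F′ : PS t} (G : PS t) → F ≗ F′ → F ⊗ G ≗ F′ ⊗ G
  ⊗-congˡ G F≗F′ = ⊗-cong F≗F′ (λ _ → refl)

  ⊗-distribʳ-⊕ : (F F′ G : PS t) → (F ⊕ F′) ⊗ G ≗ F ⊗ G ⊕ F′ ⊗ G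
  ⊗-distribʳ-⊕ F F′ G e =
    trans (∑-cong (splits e) (λ { (a , b) → ℤP.*-distribʳ-+ (G b) (F a) (F′ a) }))
          (∑-+ (splits e) (λ { (a , b) → F a * G b }) (λ { (a , b) → F′ a * G b }))

  ⊗-distribʳ-⊖ : (F F′ G : PS t) → (F ⊖ F′) ⊗ G ≗ F ⊗ G ⊖ F′ ⊗ G
  ⊗-distribʳ-⊖ F F′ G e =
    trans (∑-cong (splits e) (λ { (a , b) → distrib (F a) (F′ a) (G b) }))
          (∑-- (splits e) (λ { (a , b) → F a * G b }) (λ { (a , b) → F′ a * G b }))
    where
    distrib : ∀ x y z → (x - y) * z ≡ x * z - y * z
    distrib = solve-∀

  shift-cong : (m : Mono t) {F G : PS t} → F ≗ G → shift m F ≗ shift m G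
  shift-cong m F≗G e = cong (when (m ∣ᵇ e)) (F≗G (e / m))

  shift-cong-∣ : (m : Mono t) (F G : PS t) (e : Mono t) →
                 ((m ∣ᵇ e) ≡ true → F (e / m) ≡ G (e / m)) → shift m F e ≡ shift m G e
  shift-cong-∣ m F G e F≡G with m ∣ᵇ e
  ... | true  = F≡G refl
  ... | false = refl

  shift-qdeg : (m : Mono t) (F : PS t) (e : Mono t) → qdeg e < qdeg m → shift m F e ≡ + 0
  shift-qdeg m F e e<m with m ∣ᵇ e in m∣e
  ... | true  = ⊥-elim (ℕP.<⇒≱ e<m (subst (qdeg m ≤_) (qdeg-/ e m m∣e) (ℕP.m≤n+m _ _)))
  ... | false = refl

  shift-𝟘 : (m : Mono t) → shift m 𝟘 ≗ 𝟘
  shift-𝟘 m e with m ∣ᵇ e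
  ... | true  = refl
  ... | false = refl

  shift-⊕ : (m : Mono t) (F G : PS t) → shift m (F ⊕ G) ≗ shift m F ⊕ shift m G
  shift-⊕ m F G e = when-+ (m ∣ᵇ e) _ _

  shift-⊖ : (m : Mono t) (F G : PS t) → shift m (F ⊖ G) ≗ shift m F ⊖ shift m G
  shift-⊖ m F G e = when-- (m ∣ᵇ e) _ _

  shift-ε : (F : PS t) → shift ε F ≗ F
  shift-ε F e = cong₂ when (ε-∣ᵇ e) (cong F (/-identityʳ e))

  shift-shift : (m n : Mono t) (F : PS t) → shift m (shift n F) ≗ shift (m · n) F
  shift-shift m n F e = begin
    when (m ∣ᵇ e) (when (n ∣ᵇ e / m) (F (e / m / n)))  ≡⟨ when-∧ (m ∣ᵇ e) _ _ ⟨
    when ((m ∣ᵇ e) ∧ (n ∣ᵇ e / m)) (F (e / m / n))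
      ≡⟨ cong₂ when (sym (∣ᵇ-· m n e)) (cong F (/-/ e m n)) ⟩
    when (m · n ∣ᵇ e) (F (e / (m · n)))                ∎
    where open ≡-Reasoning

  shift-comm : (m n : Mono t) (F : PS t) → shift m (shift n F) ≗ shift n (shift m F)
  shift-comm m n F e = begin
    shift m (shift n F) e  ≡⟨ shift-shift m n F e ⟩
    shift (m · n) F e      ≡⟨ cong (λ k → shift k F e) (·-comm m n) ⟩
    shift (n · m) F e      ≡⟨ shift-shift n m F e ⟨
    shift n (shift m F) e  ∎
    where open ≡-Reasoning

  shift-mzero : (F : PS t) → shift mzero F ≗ F
  shift-mzero F e = subst (λ z → shift z F e ≡ F e) (sym mzero≡ε) (shift-ε F e)

  𝟙-⊗ : (F : PS t) → 𝟙 ⊗ F ≗ F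
  𝟙-⊗ F e = trans (mono-⊗ mzero F e) (shift-mzero F e)

  foldr-⊕ : {A : Set} (F : A → PS t) (xs : List A) (e : Mono t) →
            foldr _⊕_ 𝟘 (map F xs) e ≡ ∑[ x ∈ xs ] F x e
  foldr-⊕ F []       e = refl
  foldr-⊕ F (x ∷ xs) e = cong (_+_ (F x e)) (foldr-⊕ F xs e)

  ∑-shift : {A : Set} (ns : List A) (m : Mono t) (F : A → PS t) (e : Mono t) →
            ∑[ n ∈ ns ] shift m (F n) e ≡ shift m (λ e′ → ∑[ n ∈ ns ] F n e′) e
  ∑-shift ns m F e = ∑-when ns (m ∣ᵇ e) (λ n → F n (e / m))

  mono-· : (m n : Mono t) → mono (m · n) ≗ shift m (mono n)
  mono-· m n e = begin
    mono (m · n) e                           ≡⟨ mono-when (m · n) e ⟩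
    when (e == m · n) (+ 1)                  ≡⟨ cong (λ b → when b (+ 1)) (==-· e m n) ⟩
    when ((m ∣ᵇ e) ∧ (e / m == n)) (+ 1)     ≡⟨ when-∧ (m ∣ᵇ e) _ _ ⟩
    when (m ∣ᵇ e) (when (e / m == n) (+ 1))  ≡⟨ cong (when (m ∣ᵇ e)) (mono-when n (e / m)) ⟨
    shift m (mono n) e                       ∎
    where open ≡-Reasoning

  mono-⊗-mono-⊗ : (m n : Mono t) (F : PS t) → (mono m ⊗ mono n) ⊗ F ≗ shift m (shift n F)
  mono-⊗-mono-⊗ m n F e = begin
    ((mono m ⊗ mono n) ⊗ F) e    ≡⟨ ⊗-congˡ F (mono-⊗ m (mono n)) e ⟩
    (shift m (mono n) ⊗ F) e     ≡⟨ shift-⊗ m (mono n) F e ⟩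
    shift m (mono n ⊗ F) e       ≡⟨ shift-cong m (mono-⊗ n F) e ⟩
    shift m (shift n F) e        ∎
    where open ≡-Reasoning

  Δ : Mono t → Mono t → Mono t → PS t
  Δ q u v = mono q ⊗ (mono u ⊖ mono v)

  shiftΔ : Mono t → Mono t → Mono t → PS t → PS t
  shiftΔ q u v F = shift q (shift u F ⊖ shift v F)

  module _ (q u v : Mono t) where

    Δ-⊗ : (F : PS t) → Δ q u v ⊗ F ≗ shiftΔ q u v F
    Δ-⊗ F e = begin
      ((mono q ⊗ (mono u ⊖ mono v)) ⊗ F) e  ≡⟨ ⊗-congˡ F (mono-⊗ q (mono u ⊖ mono v)) e ⟩
      (shift q (mono u ⊖ mono v) ⊗ F) e     ≡⟨ shift-⊗ q (mono u ⊖ mono v) F e ⟩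
      shift q ((mono u ⊖ mono v) ⊗ F) e     ≡⟨ shift-cong q distrib e ⟩
      shiftΔ q u v F e                      ∎
      where
      open ≡-Reasoning
      distrib : (mono u ⊖ mono v) ⊗ F ≗ shift u F ⊖ shift v F
      distrib e′ = trans (⊗-distribʳ-⊖ (mono u) (mono v) F e′)
                         (cong₂ _-_ (mono-⊗ u F e′) (mono-⊗ v F e′))

    shiftΔ-⊗ : (F G : PS t) → shiftΔ q u v F ⊗ G ≗ shiftΔ q u v (F ⊗ G)
    shiftΔ-⊗ F G e = trans (shift-⊗ q (shift u F ⊖ shift v F) G e) (shift-cong q distrib e)
      where
      distrib : (shift u F ⊖ shift v F) ⊗ G ≗ shift u (F ⊗ G) ⊖ shift v (F ⊗ G)
      distrib e′ = trans (⊗-distribʳ-⊖ (shift u F) (shift v F) G e′)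
                         (cong₂ _-_ (shift-⊗ u F G e′) (shift-⊗ v F G e′))

    Δ-⊗-⊗ : (F G : PS t) → (Δ q u v ⊗ F) ⊗ G ≗ shiftΔ q u v (F ⊗ G)
    Δ-⊗-⊗ F G e = trans (⊗-congˡ G (Δ-⊗ F) e) (shiftΔ-⊗ F G e)

    shift-shiftΔ : (m : Mono t) (F : PS t) → shift m (shiftΔ q u v F) ≗ shiftΔ q u v (shift m F)
    shift-shiftΔ m F e = trans (shift-comm m q (shift u F ⊖ shift v F) e) (shift-cong q commute e)
      where
      commute : shift m (shift u F ⊖ shift v F) ≗ shift u (shift m F) ⊖ shift v (shift m F)
      commute e′ = trans (shift-⊖ m (shift u F) (shift v F) e′)
                         (cong₂ _-_ (shift-comm m u F e′) (shift-comm m v F e′))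

    shiftΔ-⊕ : (F G : PS t) → shiftΔ q u v (F ⊕ G) ≗ shiftΔ q u v F ⊕ shiftΔ q u v G
    shiftΔ-⊕ F G e = trans (shift-cong q regroup e) (shift-⊕ q (shift u F ⊖ shift v F) (shift u G ⊖ shift v G) e)
      where
      rearrange : ∀ a b c d → (a + b) - (c + d) ≡ (a - c) + (b - d)
      rearrange = solve-∀
      regroup : shift u (F ⊕ G) ⊖ shift v (F ⊕ G) ≗ (shift u F ⊖ shift v F) ⊕ (shift u G ⊖ shift v G)
      regroup e′ = trans (cong₂ _-_ (shift-⊕ u F G e′) (shift-⊕ v F G e′))
                         (rearrange (shift u F e′) (shift u G e′) (shift v F e′) (shift v G e′))

    shiftΔ-⊖ : (F G : PS t) → shiftΔ q u v (F ⊖ G) ≗ shiftΔ q u v F ⊖ shiftΔ q u v G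
    shiftΔ-⊖ F G e = trans (shift-cong q regroup e) (shift-⊖ q (shift u F ⊖ shift v F) (shift u G ⊖ shift v G) e)
      where
      rearrange : ∀ a b c d → (a - b) - (c - d) ≡ (a - c) - (b - d)
      rearrange = solve-∀
      regroup : shift u (F ⊖ G) ⊖ shift v (F ⊖ G) ≗ (shift u F ⊖ shift v F) ⊖ (shift u G ⊖ shift v G)
      regroup e′ = trans (cong₂ _-_ (shift-⊖ u F G e′) (shift-⊖ v F G e′))
                         (rearrange (shift u F e′) (shift u G e′) (shift v F e′) (shift v G e′))

    shiftΔ-𝟘 : shiftΔ q u v 𝟘 ≗ 𝟘
    shiftΔ-𝟘 e =
      trans (shift-cong q (λ e′ → cong₂ _-_ (shift-𝟘 u e′) (shift-𝟘 v e′)) e) (shift-𝟘 q e)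

    ∑-shiftΔ : {A : Set} (ns : List A) (F : A → PS t) (e : Mono t) →
               ∑[ n ∈ ns ] shiftΔ q u v (F n) e ≡ shiftΔ q u v (λ e′ → ∑[ n ∈ ns ] F n e′) e
    ∑-shiftΔ ns F e = begin
      ∑[ n ∈ ns ] shift q (λ e′ → shift u (F n) e′ - shift v (F n) e′) e
        ≡⟨ ∑-shift ns q (λ n e′ → shift u (F n) e′ - shift v (F n) e′) e ⟩
      shift q (λ e′ → ∑[ n ∈ ns ] (shift u (F n) e′ - shift v (F n) e′)) e
        ≡⟨ shift-cong q (λ e′ → trans (∑-- ns (λ n → shift u (F n) e′) (λ n → shift v (F n) e′))
                                      (cong₂ _-_ (∑-shift ns u F e′) (∑-shift ns v F e′))) e ⟩
      shiftΔ q u v (λ e′ → ∑[ n ∈ ns ] F n e′) e ∎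
      where open ≡-Reasoning

-- For non-constant `q`, the coefficient of `e` in `Δ q u v ⊗ F` only depends on
-- coefficients of `F` of smaller total degree (`shiftΔ-local`). Hence the powers
-- of `Δ q u v` vanish in low degrees, `inv1m` really inverts `1 - Δ q u v`, and
-- `F = N + Δ q u v ⊗ F` has exactly one solution.
module Geometric {t : ℕ} (q u v : Mono t) (q-pos : 0 < deg q) where

  shiftΔ-local : {F G : PS t} (e : Mono t) → (∀ e′ → deg e′ < deg e → F e′ ≡ G e′) →
                 shiftΔ q u v F e ≡ shiftΔ q u v G e
  shiftΔ-local {F} {G} e F≗G with q ∣ᵇ e in q∣e
  ... | false = refl
  ... | true  = cong₂ _-_ (below u) (below v)
    where
    below : ∀ m → shift m F (e / q) ≡ shift m G (e / q)
    below m with m ∣ᵇ e / q in m∣e/q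
    ... | false = refl
    ... | true  = F≗G _ (ℕP.≤-<-trans (deg-/-≤ (e / q) m m∣e/q) (deg-/-< e q q-pos q∣e))

  ^-vanish : ∀ n e → deg e < n → (Δ q u v ^ˢ n) e ≡ + 0
  ^-vanish (suc n) e e<n = begin
    (Δ q u v ⊗ (Δ q u v ^ˢ n)) e  ≡⟨ Δ-⊗ q u v (Δ q u v ^ˢ n) e ⟩
    shiftΔ q u v (Δ q u v ^ˢ n) e ≡⟨ shiftΔ-local e (λ e′ e′<e →
                                       ^-vanish n e′ (ℕP.<-≤-trans e′<e (ℕP.≤-pred e<n))) ⟩
    shiftΔ q u v 𝟘 e              ≡⟨ shiftΔ-𝟘 q u v e ⟩
    + 0                           ∎
    where open ≡-Reasoning

  ∑-^-beyond : ∀ e D → deg e < D → ∑[ n ∈ upTo D ] (Δ q u v ^ˢ n) e ≡ inv1m (Δ q u v) e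
  ∑-^-beyond e D e<D = subst (λ D → ∑[ n ∈ upTo D ] (Δ q u v ^ˢ n) e ≡ inv1m (Δ q u v) e)
                             (ℕP.m∸n+n≡m e<D) (extend (D ∸ suc (deg e)))
    where
    extend : ∀ d → ∑[ n ∈ upTo (d ℕ.+ suc (deg e)) ] (Δ q u v ^ˢ n) e ≡ inv1m (Δ q u v) e
    extend zero    = refl
    extend (suc d) = begin
      ∑[ n ∈ upTo (suc (d ℕ.+ suc (deg e))) ] (Δ q u v ^ˢ n) e
        ≡⟨ ∑-upTo-sucʳ (d ℕ.+ suc (deg e)) (λ n → (Δ q u v ^ˢ n) e) ⟩
      (∑[ n ∈ upTo (d ℕ.+ suc (deg e)) ] (Δ q u v ^ˢ n) e) + (Δ q u v ^ˢ (d ℕ.+ suc (deg e))) e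
        ≡⟨ cong₂ _+_ (extend d) (^-vanish (d ℕ.+ suc (deg e)) e (ℕP.m≤n+m (suc (deg e)) d)) ⟩
      inv1m (Δ q u v) e + + 0
        ≡⟨ ℤP.+-identityʳ _ ⟩
      inv1m (Δ q u v) e ∎
      where open ≡-Reasoning

  inv1m-unfold : inv1m (Δ q u v) ≗ 𝟙 ⊕ shiftΔ q u v (inv1m (Δ q u v))
  inv1m-unfold e = begin
    inv1m (Δ q u v) e
      ≡⟨ ∑-upTo-suc (deg e) (λ n → (Δ q u v ^ˢ n) e) ⟩
    𝟙 e + (∑[ n ∈ upTo (deg e) ] (Δ q u v ⊗ (Δ q u v ^ˢ n)) e)
      ≡⟨ cong (_+_ (𝟙 e)) (∑-cong (upTo (deg e)) (λ n → Δ-⊗ q u v (Δ q u v ^ˢ n) e)) ⟩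
    𝟙 e + (∑[ n ∈ upTo (deg e) ] shiftΔ q u v (Δ q u v ^ˢ n) e)
      ≡⟨ cong (_+_ (𝟙 e)) (∑-shiftΔ q u v (upTo (deg e)) (Δ q u v ^ˢ_) e) ⟩
    𝟙 e + shiftΔ q u v (λ e′ → ∑[ n ∈ upTo (deg e) ] (Δ q u v ^ˢ n) e′) e
      ≡⟨ cong (_+_ (𝟙 e)) (shiftΔ-local e (λ e′ e′<e → ∑-^-beyond e′ (deg e) e′<e)) ⟩
    𝟙 e + shiftΔ q u v (inv1m (Δ q u v)) e ∎
    where open ≡-Reasoning

  record IsSolution (N F : PS t) : Set where
    constructor solution
    field solves : F ≗ N ⊕ shiftΔ q u v F

  solution-unique : {N F G : PS t} → IsSolution N F → IsSolution N G → F ≗ G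
  solution-unique {N} {F} {G} (solution F-sol) (solution G-sol) e = below (suc (deg e)) e (ℕP.n<1+n (deg e))
    where
    below : ∀ n e → deg e < n → F e ≡ G e
    below (suc n) e e<n = begin
      F e                         ≡⟨ F-sol e ⟩
      N e + shiftΔ q u v F e      ≡⟨ cong (_+_ (N e)) (shiftΔ-local e (λ e′ e′<e →
                                       below n e′ (ℕP.<-≤-trans e′<e (ℕP.≤-pred e<n)))) ⟩
      N e + shiftΔ q u v G e      ≡⟨ G-sol e ⟨
      G e                         ∎
      where open ≡-Reasoning

  inv1m-solution : IsSolution 𝟙 (inv1m (Δ q u v))
  inv1m-solution = solution inv1m-unfold

  inv1m-⊗-solution : (N : PS t) → IsSolution N (inv1m (Δ q u v) ⊗ N)
  inv1m-⊗-solution N = solution λ e → begin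
    (inv1m (Δ q u v) ⊗ N) e
      ≡⟨ ⊗-congˡ N inv1m-unfold e ⟩
    ((𝟙 ⊕ shiftΔ q u v (inv1m (Δ q u v))) ⊗ N) e
      ≡⟨ ⊗-distribʳ-⊕ 𝟙 (shiftΔ q u v (inv1m (Δ q u v))) N e ⟩
    (𝟙 ⊗ N) e + (shiftΔ q u v (inv1m (Δ q u v)) ⊗ N) e
      ≡⟨ cong₂ _+_ (𝟙-⊗ N e) (shiftΔ-⊗ q u v (inv1m (Δ q u v)) N e) ⟩
    N e + shiftΔ q u v (inv1m (Δ q u v) ⊗ N) e ∎
    where open ≡-Reasoning

  solution-shift : (m : Mono t) {N F : PS t} → IsSolution N F → IsSolution (shift m N) (shift m F)
  solution-shift m {N} {F} (solution F-sol) = solution λ e →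
    trans (shift-cong m F-sol e)
          (trans (shift-⊕ m N (shiftΔ q u v F) e) (cong (_+_ (shift m N e)) (shift-shiftΔ q u v m F e)))

  solution-⊕ : {N F N′ F′ : PS t} → IsSolution N F → IsSolution N′ F′ → IsSolution (N ⊕ N′) (F ⊕ F′)
  solution-⊕ {N} {F} {N′} {F′} (solution F-sol) (solution F′-sol) = solution λ e →
    trans (cong₂ _+_ (F-sol e) (F′-sol e))
          (trans (rearrange (N e) (shiftΔ q u v F e) (N′ e) (shiftΔ q u v F′ e))
                 (cong (_+_ (N e + N′ e)) (sym (shiftΔ-⊕ q u v F F′ e))))
    where
    rearrange : ∀ a b c d → (a + b) + (c + d) ≡ (a + c) + (b + d)
    rearrange = solve-∀

  solution-⊖ : {N F N′ F′ : PS t} → IsSolution N F → IsSolution N′ F′ → IsSolution (N ⊖ N′) (F ⊖ F′)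
  solution-⊖ {N} {F} {N′} {F′} (solution F-sol) (solution F′-sol) = solution λ e →
    trans (cong₂ _-_ (F-sol e) (F′-sol e))
          (trans (rearrange (N e) (shiftΔ q u v F e) (N′ e) (shiftΔ q u v F′ e))
                 (cong (_+_ (N e - N′ e)) (sym (shiftΔ-⊖ q u v F F′ e))))
    where
    rearrange : ∀ a b c d → (a + b) - (c + d) ≡ (a - c) + (b - d)
    rearrange = solve-∀

∑-upTo-cong : ∀ n {f g : ℕ → ℤ} → (∀ x → x < n → f x ≡ g x) → ∑ (upTo n) f ≡ ∑ (upTo n) g
∑-upTo-cong zero    f≗g = refl
∑-upTo-cong (suc n) {f} {g} f≗g = begin
  ∑ (upTo (suc n)) f                 ≡⟨ ∑-upTo-suc n f ⟩
  f 0 + ∑ (upTo n) (f ∘ suc)         ≡⟨ cong₂ _+_ (f≗g 0 (s≤s z≤n))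
                                                  (∑-upTo-cong n (λ x x<n → f≗g (suc x) (s≤s x<n))) ⟩
  g 0 + ∑ (upTo n) (g ∘ suc)         ≡⟨ ∑-upTo-suc n g ⟨
  ∑ (upTo (suc n)) g                 ∎
  where open ≡-Reasoning

∑-upTo-select : ∀ n b (f : ℕ → ℤ) → b < n → ∑[ x ∈ upTo n ] when (x ≡ᵇ b) (f x) ≡ f b
∑-upTo-select (suc n) zero    f _ =
  trans (∑-upTo-suc n (λ x → when (x ≡ᵇ 0) (f x)))
        (trans (cong (_+_ (f 0)) (∑-zero (upTo n))) (ℤP.+-identityʳ (f 0)))
∑-upTo-select (suc n) (suc b) f (s≤s b<n) =
  trans (∑-upTo-suc n (λ x → when (x ≡ᵇ suc b) (f x)))
        (trans (ℤP.+-identityˡ _) (∑-upTo-select n b (f ∘ suc) b<n))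

∑-upTo-below : ∀ n s (f : ℕ → ℤ) → s ≤ n → ∑[ x ∈ upTo n ] when (x <ᵇ s) (f x) ≡ ∑ (upTo s) f
∑-upTo-below n       zero    f _         = ∑-zero (upTo n)
∑-upTo-below (suc n) (suc s) f (s≤s s≤n) = begin
  ∑[ x ∈ upTo (suc n) ] when (x <ᵇ suc s) (f x)    ≡⟨ ∑-upTo-suc n (λ x → when (x <ᵇ suc s) (f x)) ⟩
  f 0 + (∑[ x ∈ upTo n ] when (x <ᵇ s) (f (suc x))) ≡⟨ cong (_+_ (f 0)) (∑-upTo-below n s (f ∘ suc) s≤n) ⟩
  f 0 + ∑ (upTo s) (f ∘ suc)                       ≡⟨ ∑-upTo-suc s f ⟨
  ∑ (upTo (suc s)) f                               ∎
  where open ≡-Reasoning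

module _ (k : ℕ) where

  ∑-letters-cong : {f g : ℕ → ℤ} → (∀ b → 1 ≤ b → b ≤ k → f b ≡ g b) →
                   ∑ (letters k) f ≡ ∑ (letters k) g
  ∑-letters-cong {f} {g} f≗g =
    trans (∑-map (upTo k) suc f)
          (trans (∑-upTo-cong k (λ x x<k → f≗g (suc x) (s≤s z≤n) x<k)) (sym (∑-map (upTo k) suc g)))

  ∑-letters-select : ∀ b (f : ℕ → ℤ) → 1 ≤ b → b ≤ k → ∑[ a ∈ letters k ] when (a ≡ᵇ b) (f a) ≡ f b
  ∑-letters-select (suc b) f _ b<k =
    trans (∑-map (upTo k) suc (λ a → when (a ≡ᵇ suc b) (f a))) (∑-upTo-select k b (f ∘ suc) b<k)

  ∑-letters-below : ∀ s (f : ℕ → ℤ) → 1 ≤ s → s ≤ k →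
                    ∑[ b ∈ letters k ] when (b <ᵇ s) (f b) ≡ ∑ (map suc (upTo (s ∸ 1))) f
  ∑-letters-below (suc s) f _ s<k = begin
    ∑[ b ∈ letters k ] when (b <ᵇ suc s) (f b)        ≡⟨ ∑-map (upTo k) suc (λ b → when (b <ᵇ suc s) (f b)) ⟩
    ∑[ x ∈ upTo k ] when (x <ᵇ s) (f (suc x))         ≡⟨ ∑-upTo-below k s (f ∘ suc) (ℕP.<⇒≤ s<k) ⟩
    ∑ (upTo s) (f ∘ suc)                              ≡⟨ ∑-map (upTo s) suc f ⟨
    ∑ (map suc (upTo s)) f                            ∎
    where open ≡-Reasoning

  ∑-words-suc : ∀ n (f : List ℕ → ℤ) →
                ∑ (words k (suc n)) f ≡ ∑[ a ∈ letters k ] ∑[ w ∈ words k n ] f (a ∷ w)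
  ∑-words-suc n f = trans (∑-concatMap (letters k) (λ a → map (a ∷_) (words k n)) f)
                          (∑-cong (letters k) (λ a → ∑-map (words k n) (a ∷_) f))

module Words {t : ℕ} (blk : ℕ → Fin t) (k : ℕ) where

  count-∑ : ∀ e (πs : List (List ℕ)) →
            + length (filter (λ π → stat blk π ≟M e) πs) ≡ ∑[ π ∈ πs ] mono (stat blk π) e
  count-∑ e []       = refl
  count-∑ e (π ∷ πs) with stat blk π ≟M e
  ... | yes refl = trans (cong (_+_ (+ 1)) (count-∑ _ πs))
                         (cong (_+ (∑[ π′ ∈ πs ] mono (stat blk π′) (stat blk π))) (sym (mono-refl (stat blk π))))
  ... | no  π≢e  = trans (count-∑ e πs) (sym (trans (cong (_+ _) (mono-≢ (π≢e ∘ sym))) (ℤP.+-identityˡ _)))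

  Aj-∑ : ∀ b e → Aj blk k b e ≡ ∑[ π ∈ words k (qdeg e) ] when (headIs b π) (mono (stat blk π) e)
  Aj-∑ b e = trans (count-∑ e (List.filterᵇ (headIs b) (words k (qdeg e))))
                   (∑-filterᵇ (headIs b) (words k (qdeg e)) (λ π → mono (stat blk π) e))

  Aj-empty : ∀ b e → qdeg e ≡ 0 → Aj blk k b e ≡ + 0
  Aj-empty b e qdeg-e rewrite qdeg-e = refl

  Aj-cons : ∀ b e n → 1 ≤ b → b ≤ k → qdeg e ≡ suc n →
            Aj blk k b e ≡ ∑[ w ∈ words k n ] mono (stat blk (b ∷ w)) e
  Aj-cons b e n 1≤b b≤k qdeg-e = begin
    Aj blk k b e
      ≡⟨ Aj-∑ b e ⟩
    ∑[ π ∈ words k (qdeg e) ] when (headIs b π) (mono (stat blk π) e)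
      ≡⟨ cong (λ m → ∑[ π ∈ words k m ] when (headIs b π) (mono (stat blk π) e)) qdeg-e ⟩
    ∑[ π ∈ words k (suc n) ] when (headIs b π) (mono (stat blk π) e)
      ≡⟨ ∑-words-suc k n (λ π → when (headIs b π) (mono (stat blk π) e)) ⟩
    ∑[ a ∈ letters k ] ∑[ w ∈ words k n ] when (a ≡ᵇ b) (mono (stat blk (a ∷ w)) e)
      ≡⟨ ∑-cong (letters k) (λ a → ∑-when (words k n) (a ≡ᵇ b) (λ w → mono (stat blk (a ∷ w)) e)) ⟩
    ∑[ a ∈ letters k ] when (a ≡ᵇ b) (∑[ w ∈ words k n ] mono (stat blk (a ∷ w)) e)
      ≡⟨ ∑-letters-select k b (λ a → ∑[ w ∈ words k n ] mono (stat blk (a ∷ w)) e) 1≤b b≤k ⟩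
    ∑[ w ∈ words k n ] mono (stat blk (b ∷ w)) e ∎
    where open ≡-Reasoning

  ∑Aj : PS t
  ∑Aj e = ∑[ b ∈ letters k ] Aj blk k b e

  A-split : A blk k ≗ 𝟙 ⊕ ∑Aj
  A-split e = trans (count-∑ e (words k (qdeg e))) (byLength (qdeg e) refl)
    where
    byLength : ∀ n → qdeg e ≡ n → ∑[ π ∈ words k n ] mono (stat blk π) e ≡ 𝟙 e + ∑Aj e
    byLength zero    qdeg-e =
      cong (_+_ (𝟙 e)) (sym (trans (∑-cong (letters k) (λ b → Aj-empty b e qdeg-e)) (∑-zero (letters k))))
    byLength (suc n) qdeg-e = begin
      ∑[ π ∈ words k (suc n) ] mono (stat blk π) e
        ≡⟨ ∑-words-suc k n (λ π → mono (stat blk π) e) ⟩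
      ∑[ a ∈ letters k ] ∑[ w ∈ words k n ] mono (stat blk (a ∷ w)) e
        ≡⟨ ∑-letters-cong k (λ a 1≤a a≤k → sym (Aj-cons a e n 1≤a a≤k qdeg-e)) ⟩
      ∑Aj e
        ≡⟨ ℤP.+-identityˡ (∑Aj e) ⟨
      + 0 + ∑Aj e
        ≡⟨ cong (_+ ∑Aj e) (𝟙-qdeg-suc e qdeg-e) ⟨
      𝟙 e + ∑Aj e ∎
      where open ≡-Reasoning

  module FirstLetter (s : ℕ) (1≤s : 1 ≤ s) (s≤k : s ≤ k) where

    qᵢ xᵢ yᵢ zᵢ : Mono t
    qᵢ = unitAt (blk s) (0 , 0 , 0 , 1)
    xᵢ = unitAt (blk s) (1 , 0 , 0 , 0)
    yᵢ = unitAt (blk s) (0 , 1 , 0 , 0)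
    zᵢ = unitAt (blk s) (0 , 0 , 1 , 0)

    pairMono : ℕ → Mono t
    pairMono b = unitAt (blk s) (pairStat s b)

    Aₛ ∑A<ₛ : PS t
    Aₛ   = Aj blk k s
    ∑A<ₛ = sumAj blk k s

    qᵢ-pos : 0 < deg qᵢ
    qᵢ-pos = subst (0 <_) (sym (deg-unitAt (blk s) 0 0 0 1)) ℕP.0<1+n

    qdeg-qᵢ : qdeg qᵢ ≡ 1
    qdeg-qᵢ = qdeg-unitAt (blk s) 0 0 0 1

    qdeg-/-qᵢ : ∀ e → (qᵢ ∣ᵇ e) ≡ true → suc (qdeg (e / qᵢ)) ≡ qdeg e
    qdeg-/-qᵢ e q∣e =
      trans (ℕP.+-comm 1 _) (trans (cong (qdeg (e / qᵢ) ℕ.+_) (sym qdeg-qᵢ)) (qdeg-/ e qᵢ q∣e))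

    qdeg-/-pairMono : ∀ b e → (pairMono b ∣ᵇ e) ≡ true → qdeg (e / pairMono b) ≡ qdeg e
    qdeg-/-pairMono b e b∣e =
      trans (sym (ℕP.+-identityʳ _))
            (trans (cong (qdeg (e / pairMono b) ℕ.+_) (sym qdeg-pairMono)) (qdeg-/ e (pairMono b) b∣e))
      where
      qdeg-pairMono : qdeg (pairMono b) ≡ 0
      qdeg-pairMono with b <ᵇ s | s <ᵇ b
      ... | true  | _     = qdeg-unitAt (blk s) 1 0 0 0
      ... | false | true  = qdeg-unitAt (blk s) 0 1 0 0
      ... | false | false = qdeg-unitAt (blk s) 0 0 1 0

    afterFirst : List ℕ → PS t
    afterFirst []      = 𝟙
    afterFirst (b ∷ w) = shift (pairMono b) (mono (stat blk (b ∷ w)))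

    mono-stat-first : ∀ π → mono (stat blk (s ∷ π)) ≗ shift qᵢ (afterFirst π)
    mono-stat-first []      e =
      trans (cong (λ m → mono m e) (addAt-· (blk s) (0 , 0 , 0 , 1) mzero)) (mono-· qᵢ mzero e)
    mono-stat-first (b ∷ w) e = begin
      mono (stat blk (s ∷ b ∷ w)) e
        ≡⟨ cong (λ m → mono m e) (trans (addAt-· (blk s) _ _) (cong (qᵢ ·_) (addAt-· (blk s) (pairStat s b) _))) ⟩
      mono (qᵢ · (pairMono b · stat blk (b ∷ w))) e
        ≡⟨ mono-· qᵢ _ e ⟩
      shift qᵢ (mono (pairMono b · stat blk (b ∷ w))) e
        ≡⟨ shift-cong qᵢ (mono-· (pairMono b) (stat blk (b ∷ w))) e ⟩
      shift qᵢ (afterFirst (b ∷ w)) e ∎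
      where open ≡-Reasoning

    ∑pairAj : PS t
    ∑pairAj e = ∑[ b ∈ letters k ] shift (pairMono b) (Aj blk k b) e

    ∑-afterFirst : ∀ e → ∑[ π ∈ words k (qdeg e) ] afterFirst π e ≡ 𝟙 e + ∑pairAj e
    ∑-afterFirst e = byLength (qdeg e) refl
      where
      continuations : ℕ → ℕ → PS t
      continuations n b e′ = ∑[ w ∈ words k n ] mono (stat blk (b ∷ w)) e′
      byLength : ∀ n → qdeg e ≡ n → ∑[ π ∈ words k n ] afterFirst π e ≡ 𝟙 e + ∑pairAj e
      byLength zero    qdeg-e = cong (_+_ (𝟙 e)) (sym (trans (∑-cong (letters k) noPair) (∑-zero (letters k))))
        where
        noPair : ∀ b → shift (pairMono b) (Aj blk k b) e ≡ + 0
        noPair b = trans (shift-cong-∣ (pairMono b) (Aj blk k b) 𝟘 e (λ b∣e →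
                            Aj-empty b (e / pairMono b) (trans (qdeg-/-pairMono b e b∣e) qdeg-e)))
                         (shift-𝟘 (pairMono b) e)
      byLength (suc n) qdeg-e = begin
        ∑[ π ∈ words k (suc n) ] afterFirst π e
          ≡⟨ ∑-words-suc k n (λ π → afterFirst π e) ⟩
        ∑[ b ∈ letters k ] ∑[ w ∈ words k n ] shift (pairMono b) (mono (stat blk (b ∷ w))) e
          ≡⟨ ∑-cong (letters k) (λ b → ∑-shift (words k n) (pairMono b) (λ w → mono (stat blk (b ∷ w))) e) ⟩
        ∑[ b ∈ letters k ] shift (pairMono b) (continuations n b) e
          ≡⟨ ∑-letters-cong k (λ b 1≤b b≤k → shift-cong-∣ (pairMono b) (continuations n b) (Aj blk k b) e
               (λ b∣e → sym (Aj-cons b (e / pairMono b) n 1≤b b≤k (trans (qdeg-/-pairMono b e b∣e) qdeg-e)))) ⟩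
        ∑pairAj e
          ≡⟨ ℤP.+-identityˡ (∑pairAj e) ⟨
        + 0 + ∑pairAj e
          ≡⟨ cong (_+ ∑pairAj e) (𝟙-qdeg-suc e qdeg-e) ⟨
        𝟙 e + ∑pairAj e ∎
        where open ≡-Reasoning

    Aₛ-first : Aₛ ≗ shift qᵢ (𝟙 ⊕ ∑pairAj)
    Aₛ-first e = byLength (qdeg e) refl
      where
      byLength : ∀ n → qdeg e ≡ n → Aₛ e ≡ shift qᵢ (𝟙 ⊕ ∑pairAj) e
      byLength zero    qdeg-e = trans (Aj-empty s e qdeg-e)
        (sym (shift-qdeg qᵢ (𝟙 ⊕ ∑pairAj) e (subst₂ _<_ (sym qdeg-e) (sym qdeg-qᵢ) ℕP.0<1+n)))
      byLength (suc n) qdeg-e = begin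
        Aₛ e
          ≡⟨ Aj-cons s e n 1≤s s≤k qdeg-e ⟩
        ∑[ π ∈ words k n ] mono (stat blk (s ∷ π)) e
          ≡⟨ ∑-cong (words k n) (λ π → mono-stat-first π e) ⟩
        ∑[ π ∈ words k n ] shift qᵢ (afterFirst π) e
          ≡⟨ ∑-shift (words k n) qᵢ afterFirst e ⟩
        shift qᵢ (λ e′ → ∑[ π ∈ words k n ] afterFirst π e′) e
          ≡⟨ shift-cong-∣ qᵢ (λ e′ → ∑[ π ∈ words k n ] afterFirst π e′) (𝟙 ⊕ ∑pairAj) e (λ q∣e →
               trans (cong (λ m → ∑[ π ∈ words k m ] afterFirst π (e / qᵢ)) (qdeg-/-qᵢ-suc q∣e))
                     (∑-afterFirst (e / qᵢ))) ⟩
        shift qᵢ (𝟙 ⊕ ∑pairAj) e ∎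
        where
        open ≡-Reasoning
        qdeg-/-qᵢ-suc : (qᵢ ∣ᵇ e) ≡ true → n ≡ qdeg (e / qᵢ)
        qdeg-/-qᵢ-suc q∣e = sym (ℕP.suc-injective (trans (qdeg-/-qᵢ e q∣e) qdeg-e))

    pair-weight : ∀ b (F : PS t) e →
      shift (pairMono b) F e
      ≡ shift yᵢ F e + when (b <ᵇ s) (shift xᵢ F e - shift yᵢ F e) + when (b ≡ᵇ s) (shift zᵢ F e - shift yᵢ F e)
    pair-weight b F e rewrite ≡ᵇ-trichotomy b s with b <ᵇ s | s <ᵇ b
    ... | true  | _     = descent (shift xᵢ F e) (shift yᵢ F e)
      where
      descent : ∀ x y → x ≡ y + (x - y) + + 0
      descent = solve-∀
    ... | false | true  = sym (trans (ℤP.+-identityʳ _) (ℤP.+-identityʳ _))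
    ... | false | false = level (shift zᵢ F e) (shift yᵢ F e)
      where
      level : ∀ z y → z ≡ y + + 0 + (z - y)
      level = solve-∀

    ∑pairAj-split :
      ∑pairAj ≗ shift yᵢ ∑Aj ⊕ (shift xᵢ ∑A<ₛ ⊖ shift yᵢ ∑A<ₛ) ⊕ (shift zᵢ Aₛ ⊖ shift yᵢ Aₛ)
    ∑pairAj-split e = begin
      ∑pairAj e
        ≡⟨ ∑-cong (letters k) (λ b → pair-weight b (Aj blk k b) e) ⟩
      ∑[ b ∈ letters k ] (Y b + when (b <ᵇ s) (X b - Y b) + when (b ≡ᵇ s) (Z b - Y b))
        ≡⟨ ∑-+ (letters k) (λ b → Y b + when (b <ᵇ s) (X b - Y b)) (λ b → when (b ≡ᵇ s) (Z b - Y b)) ⟩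
      (∑[ b ∈ letters k ] (Y b + when (b <ᵇ s) (X b - Y b))) + (∑[ b ∈ letters k ] when (b ≡ᵇ s) (Z b - Y b))
        ≡⟨ cong₂ _+_ (∑-+ (letters k) Y (λ b → when (b <ᵇ s) (X b - Y b)))
                     (∑-letters-select k s (λ b → Z b - Y b) 1≤s s≤k) ⟩
      ∑ (letters k) Y + (∑[ b ∈ letters k ] when (b <ᵇ s) (X b - Y b)) + (Z s - Y s)
        ≡⟨ cong (_+ (Z s - Y s)) (cong₂ _+_ (∑-shift (letters k) yᵢ (Aj blk k) e)
                                             (∑-letters-below k s (λ b → X b - Y b) 1≤s s≤k)) ⟩
      shift yᵢ ∑Aj e + (∑[ b ∈ smaller ] (X b - Y b)) + (Z s - Y s)
        ≡⟨ cong (λ c → shift yᵢ ∑Aj e + c + (Z s - Y s)) (∑-- smaller X Y) ⟩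
      shift yᵢ ∑Aj e + (∑ smaller X - ∑ smaller Y) + (Z s - Y s)
        ≡⟨ cong (λ c → shift yᵢ ∑Aj e + c + (Z s - Y s)) (cong₂ _-_ (shift-∑A<ₛ xᵢ) (shift-∑A<ₛ yᵢ)) ⟩
      shift yᵢ ∑Aj e + (shift xᵢ ∑A<ₛ e - shift yᵢ ∑A<ₛ e) + (Z s - Y s) ∎
      where
      open ≡-Reasoning
      smaller : List ℕ
      smaller = map suc (upTo (s ∸ 1))
      X Y Z : ℕ → ℤ
      X b = shift xᵢ (Aj blk k b) e
      Y b = shift yᵢ (Aj blk k b) e
      Z b = shift zᵢ (Aj blk k b) e
      shift-∑A<ₛ : ∀ m → ∑[ b ∈ smaller ] shift m (Aj blk k b) e ≡ shift m ∑A<ₛ e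
      shift-∑A<ₛ m = trans (∑-shift smaller m (Aj blk k) e)
                          (shift-cong m (λ e′ → sym (foldr-⊕ (Aj blk k) smaller e′)) e)

    open Geometric qᵢ zᵢ yᵢ qᵢ-pos

    numerator : PS t
    numerator = shift qᵢ (shift yᵢ (A blk k)) ⊕ shift qᵢ (𝟙 ⊖ shift yᵢ 𝟙) ⊕ shiftΔ qᵢ xᵢ yᵢ ∑A<ₛ

    Aₛ-solution : IsSolution numerator Aₛ
    Aₛ-solution = solution λ e → begin
      Aₛ e
        ≡⟨ Aₛ-first e ⟩
      shift qᵢ (𝟙 ⊕ ∑pairAj) e
        ≡⟨ shift-cong qᵢ regroup e ⟩
      shift qᵢ (M₁ ⊕ M₂ ⊕ M₃ ⊕ M₄) e
        ≡⟨ shift-⊕ qᵢ (M₁ ⊕ M₂ ⊕ M₃) M₄ e ⟩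
      shift qᵢ (M₁ ⊕ M₂ ⊕ M₃) e + shift qᵢ M₄ e
        ≡⟨ cong (_+ shift qᵢ M₄ e) (shift-⊕ qᵢ (M₁ ⊕ M₂) M₃ e) ⟩
      shift qᵢ (M₁ ⊕ M₂) e + shift qᵢ M₃ e + shift qᵢ M₄ e
        ≡⟨ cong (λ c → c + shift qᵢ M₃ e + shift qᵢ M₄ e) (shift-⊕ qᵢ M₁ M₂ e) ⟩
      numerator e + shiftΔ qᵢ zᵢ yᵢ Aₛ e ∎
      where
      open ≡-Reasoning
      M₁ M₂ M₃ M₄ : PS t
      M₁ = shift yᵢ (A blk k)
      M₂ = 𝟙 ⊖ shift yᵢ 𝟙
      M₃ = shift xᵢ ∑A<ₛ ⊖ shift yᵢ ∑A<ₛ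
      M₄ = shift zᵢ Aₛ ⊖ shift yᵢ Aₛ
      rearrange : ∀ o y a m₃ m₄ → o + (a + m₃ + m₄) ≡ y + a + (o - y) + m₃ + m₄
      rearrange = solve-∀
      regroup : 𝟙 ⊕ ∑pairAj ≗ M₁ ⊕ M₂ ⊕ M₃ ⊕ M₄
      regroup e′ = begin
        𝟙 e′ + ∑pairAj e′
          ≡⟨ cong (_+_ (𝟙 e′)) (∑pairAj-split e′) ⟩
        𝟙 e′ + (shift yᵢ ∑Aj e′ + M₃ e′ + M₄ e′)
          ≡⟨ rearrange (𝟙 e′) (shift yᵢ 𝟙 e′) (shift yᵢ ∑Aj e′) (M₃ e′) (M₄ e′) ⟩
        shift yᵢ 𝟙 e′ + shift yᵢ ∑Aj e′ + M₂ e′ + M₃ e′ + M₄ e′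
          ≡⟨ cong (λ c → c + M₂ e′ + M₃ e′ + M₄ e′)
                  (trans (shift-cong yᵢ A-split e′) (shift-⊕ yᵢ 𝟙 ∑Aj e′)) ⟨
        M₁ e′ + M₂ e′ + M₃ e′ + M₄ e′ ∎

    D⁻¹ : PS t
    D⁻¹ = inv1m (Δ qᵢ zᵢ yᵢ)

    closedForm : PS t
    closedForm = shift qᵢ (shift yᵢ (D⁻¹ ⊗ A blk k))
               ⊕ shift qᵢ (D⁻¹ ⊖ shift yᵢ D⁻¹)
               ⊕ shiftΔ qᵢ xᵢ yᵢ (D⁻¹ ⊗ ∑A<ₛ)

    closedForm-solution : IsSolution numerator closedForm
    closedForm-solution =
      solution-⊕ (solution-⊕ (solution-shift qᵢ (solution-shift yᵢ (inv1m-⊗-solution (A blk k))))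
                             (solution-shift qᵢ (solution-⊖ inv1m-solution (solution-shift yᵢ inv1m-solution))))
                 (solution-shift qᵢ (solution-⊖ (solution-shift xᵢ (inv1m-⊗-solution ∑A<ₛ))
                                                (solution-shift yᵢ (inv1m-⊗-solution ∑A<ₛ))))

    Aₛ≗closedForm : Aₛ ≗ closedForm
    Aₛ≗closedForm = solution-unique Aₛ-solution closedForm-solution

    quotients≗closedForm :
      (mono qᵢ ⊗ mono yᵢ) ÷1- Δ qᵢ zᵢ yᵢ ⊗ A blk k
        ⊕ Δ qᵢ mzero yᵢ ÷1- Δ qᵢ zᵢ yᵢ
        ⊕ Δ qᵢ xᵢ yᵢ ÷1- Δ qᵢ zᵢ yᵢ ⊗ ∑A<ₛ
      ≗ closedForm
    quotients≗closedForm e = cong₂ _+_ (cong₂ _+_ first (second e)) (Δ-⊗-⊗ qᵢ xᵢ yᵢ D⁻¹ ∑A<ₛ e)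
      where
      first : (((mono qᵢ ⊗ mono yᵢ) ⊗ D⁻¹) ⊗ A blk k) e ≡ shift qᵢ (shift yᵢ (D⁻¹ ⊗ A blk k)) e
      first = begin
        (((mono qᵢ ⊗ mono yᵢ) ⊗ D⁻¹) ⊗ A blk k) e  ≡⟨ ⊗-congˡ (A blk k) (mono-⊗-mono-⊗ qᵢ yᵢ D⁻¹) e ⟩
        (shift qᵢ (shift yᵢ D⁻¹) ⊗ A blk k) e      ≡⟨ shift-⊗ qᵢ (shift yᵢ D⁻¹) (A blk k) e ⟩
        shift qᵢ (shift yᵢ D⁻¹ ⊗ A blk k) e        ≡⟨ shift-cong qᵢ (shift-⊗ yᵢ D⁻¹ (A blk k)) e ⟩
        shift qᵢ (shift yᵢ (D⁻¹ ⊗ A blk k)) e      ∎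
        where open ≡-Reasoning
      second : Δ qᵢ mzero yᵢ ⊗ D⁻¹ ≗ shift qᵢ (D⁻¹ ⊖ shift yᵢ D⁻¹)
      second e′ = trans (Δ-⊗ qᵢ mzero yᵢ D⁻¹ e′)
                        (shift-cong qᵢ (λ e″ → cong (_- shift yᵢ D⁻¹ e″) (shift-mzero D⁻¹ e″)) e′)

lemma2p1 : (t k : ℕ) (blk : ℕ → Fin t)
    → ((m : Fin t) → Σ ℕ (λ n → (1 ≤ n) × (blk n ≡ m)))
    → 1 ≤ k
    → (i : Fin t) (s : ℕ) → blk s ≡ i → 1 ≤ s → s ≤ k
    → (e : Mono t)
    → Aj blk k s e
      ≡ ( (qv i ⊗ yv i) ÷1- (qv i ⊗ (zv i ⊖ yv i)) ⊗ A blk k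
        ⊕ (qv i ⊗ (𝟙 ⊖ yv i)) ÷1- (qv i ⊗ (zv i ⊖ yv i))
        ⊕ (qv i ⊗ (xv i ⊖ yv i)) ÷1- (qv i ⊗ (zv i ⊖ yv i)) ⊗ sumAj blk k s ) e
lemma2p1 t k blk _ _ .(blk s) s refl 1≤s s≤k e = trans (Aₛ≗closedForm e) (sym (quotients≗closedForm e))
  where open Words.FirstLetter blk k s 1≤s s≤k
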